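{- Let $S$ be a string over an alphabet of size $\sigma$. Then for any positive integer $l$ there exists (and can be constructed) a parsing $Y_S$ of $S$ with $|Y_S| \leq \lceil |S|/l \rceil + 1$ such that $$|Y_S| H_1(Y_S) \leq \frac{|S|}{l} \sum_{i=l}^{2l-1} H_i(S) + O(\log |S|),$$ all phrases of $Y_S$ except the first and the last have length exactly $l$, and all phrases have length at most $l$.
   Context: All logarithms are base 2. For a string $T$ over an alphabet $\Gamma$ and a letter $a$, let $|T|_a$ be the number of occurrences of $a$ in $T$. The zeroth-order empirical entropy is $H_0(T) = -\sum_{a} \frac{|T|_a}{|T|}\log\frac{|T|_a}{|T|}$ (and $|T|H_0(T)=0$ for empty $T$). For $k\ge 1$, the $k$-th order empirical entropy is defined by $|T|H_k(T) = \sum_{w \in \Gamma^k} |T_w| H_0(T_w)$, where $T_w$ is the string obtained by concatenating, in order, all letters of $T$ that are immediately preceded by an occurrence of $w$. A parsing of $S$ is a sequence $Y_S=y_1,\ldots,y_t$ of nonempty strings whose concatenation is $S$; $|Y_S|=t$. The parsing is viewed as a string of length $t$ over a new alphabet whose letters are the distinct phrases, and $H_1(Y_S)$ is the first-order empirical entropy of this string. -}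

module Defs where

open import Data.Nat using (ℕ; zero; suc; _+_; _*_; _∸_; _^_)
open import Data.Fin using (Fin)
open import Data.Fin.Properties using () renaming (_≟_ to _≟F_)
open import Data.List using (List; []; _∷_; length; filter; map; take; drop; deduplicate)
open import Data.Nat.ListAction using (product)
import Data.List.Properties as LP
import Data.Product.Properties as PP
open import Data.Product using (_×_; _,_; proj₁)
open import Relation.Binary.Definitions using (DecidableEquality)
open import Relation.Binary.PropositionalEquality using (_≡_)

count : {B : Set} → DecidableEquality B → B → List B → ℕ
count _≟_ b xs = length (filter (_≟_ b) xs)

pp : {B : Set} → DecidableEquality B → List B → ℕ
pp _≟_ xs = product (map (λ b → count _≟_ b xs ^ count _≟_ b xs) (deduplicate _≟_ xs))

ctxPairs : {A : Set} → ℕ → List A → List (List A × A)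
ctxPairs k [] = []
ctxPairs k (x ∷ xs) with drop k (x ∷ xs)
... | [] = []
... | a ∷ _ = (take k (x ∷ xs) , a) ∷ ctxPairs k xs

-- |T| H_k(T) = Σ_w |T_w| H_0(T_w) = Σ_w ( |T_w| log |T_w| - Σ_a n_{w,a} log n_{w,a} )
-- where n_{w,a} = number of occurrences of a preceded by w.  Hence
--   2^(|T| H_k(T)) = entNum k T / entDen k T   (exactly, a positive rational).
entNum : {A : Set} → DecidableEquality A → ℕ → List A → ℕ
entNum _≟_ k T = pp (LP.≡-dec _≟_) (map proj₁ (ctxPairs k T))

entDen : {A : Set} → DecidableEquality A → ℕ → List A → ℕ
entDen _≟_ k T = pp (PP.≡-dec (LP.≡-dec _≟_) _≟_) (ctxPairs k T)

Str : ℕ → Set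
Str σ = List (Fin σ)

decStr : (σ : ℕ) → DecidableEquality (Str σ)
decStr σ = LP.≡-dec _≟F_

prodRange : ℕ → (ℕ → ℕ) → ℕ
prodRange l f = product (map (λ j → f (l + j)) (Data.List.upTo l))

{-# OPTIONS --safe #-}

-- For a shift f < l, cut S into a first phrase of length f + 1, then blocks of length l, then the
-- rest. Up to its first and last transition, which cost a factor polynomial in |S|, |Y| H₁(Y) is
-- the empirical entropy of a block given the previous block. The chain rule splits it into l
-- terms: the (k + 1)-st letter of a block given the previous block and the first k letters of the
-- current one, i.e. given a context of length l + k. By Gibbs' inequality each term is at most
-- the cross-entropy against the statistics of all contexts of length l + k in S, and over the l
-- shifts these positions partition the occurrences of such contexts in S, so the sum over all
-- shifts is at most |S| Σ_{k<l} H_{l+k}(S); the best shift is no worse than the average.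
-- Every 2^(|T| H_k(T)) is kept as the exact ratio entNum / entDen of natural numbers, so all
-- inequalities between entropies become cross-multiplied inequalities in ℕ.

module Submission where

open import Data.Empty using (⊥-elim)
open import Data.Fin as Fin using (Fin; toℕ)
open import Data.Fin.Properties using () renaming (_≟_ to _≟F_)
open import Data.List using (List; []; _∷_; [_]; _++_; length; map; filter; take; drop; concat; lookup; replicate; deduplicate; applyUpTo)
open import Data.List.Properties using (length-++; length-map; length-take; length-drop; length-filter; length-replicate; map-∘; map-cong; map-++; filter-++; filter-reject; take-take; take-all; drop-drop; drop-all; take++drop≡id; ++-assoc; ++-identityʳ; ∷-injective; ∷ʳ-injective; concat-++)
import Data.List.Properties as Listₚ
open import Data.List.Relation.Unary.All as All using (All; []; _∷_)
import Data.List.Relation.Unary.All.Properties as Allₚ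
open import Data.List.Relation.Binary.Sublist.Propositional using (_⊆_; []; _∷_; _∷ʳ_; ⊆-refl; ⊆-trans; minimum)
open import Data.List.Relation.Binary.Sublist.Propositional.Properties using (drop-⊆; filter-⊆)
open import Data.Nat
open import Data.Nat.DivMod using (_%_; m/n*n≤m; m*n/n≡m; /-monoˡ-≤; m%n<n; m≡m%n+[m/n]*n)
open import Data.Nat.Induction using (<-wellFounded)
open import Data.Nat.ListAction using (sum; product)
open import Data.Nat.ListAction.Properties using (sum-++; product-++)
open import Data.Nat.Properties
open import Algebra.Properties.CommutativeSemigroup *-commutativeSemigroup using (x∙yz≈y∙xz; x∙yz≈yx∙z; xy∙z≈zy∙x; xy∙z≈x∙zy) renaming (interchange to *-interchange)
open import Algebra.Properties.CommutativeSemigroup +-commutativeSemigroup using () renaming (interchange to +-interchange)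
open import Data.Nat.Tactic.RingSolver using (solve-∀)
open import Data.Product using (Σ; _×_; _,_; proj₁; proj₂; uncurry)
import Data.Product.Properties as Productₚ
open import Data.Sum using (_⊎_; inj₁; inj₂; [_,_]′)
open import Function using (_∘_; _$_; id)
open import Induction.WellFounded using (Acc; acc)
open import Relation.Binary.Definitions using (DecidableEquality)
open import Relation.Binary.PropositionalEquality hiding ([_])
open import Relation.Nullary using (yes; no; ¬_; ¬?)
open import Relation.Unary using (Decidable)

open import Defs

-- Ratios of natural numbers

infix 4 _≼_
infixl 7 _⊗_

-- The pair (a , b) stands for the ratio a / b.
record _≼_ (p q : ℕ × ℕ) : Set where
  constructor mk≼
  field cross-≤ : proj₁ p * proj₂ q ≤ proj₂ p * proj₁ q
open _≼_

_⊗_ : ℕ × ℕ → ℕ × ℕ → ℕ × ℕ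
(a , b) ⊗ (c , d) = a * c , b * d

≼-refl : ∀ p → p ≼ p
≼-refl (a , b) = mk≼ (≤-reflexive (*-comm a b))

≼-trans : ∀ {p q r} → 0 < proj₂ q → p ≼ q → q ≼ r → p ≼ r
≼-trans {a , b} {c , d} {e , f} d>0 (mk≼ ad≤bc) (mk≼ cf≤de) = mk≼ (*-cancelˡ-≤ d {{>-nonZero d>0}} (begin
  d * (a * f)  ≡⟨ x∙yz≈yx∙z d a f ⟩
  a * d * f    ≤⟨ *-monoˡ-≤ f ad≤bc ⟩
  b * c * f    ≡⟨ *-assoc b c f ⟩
  b * (c * f)  ≤⟨ *-monoʳ-≤ b cf≤de ⟩
  b * (d * e)  ≡⟨ x∙yz≈y∙xz b d e ⟩
  d * (b * e)  ∎))
  where open ≤-Reasoning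

⊗-mono-≼ : ∀ {p q r s} → p ≼ q → r ≼ s → p ⊗ r ≼ q ⊗ s
⊗-mono-≼ {a , b} {c , d} {e , f} {g , h} (mk≼ ad≤bc) (mk≼ eh≤fg) = mk≼ (begin
  a * e * (d * h)  ≡⟨ *-interchange a e d h ⟩
  a * d * (e * h)  ≤⟨ *-mono-≤ ad≤bc eh≤fg ⟩
  b * c * (f * g)  ≡⟨ *-interchange b c f g ⟩
  b * f * (c * g)  ∎)
  where open ≤-Reasoning

⊗-telescope-≼ : ∀ {a b c p q} → 0 < b → (a , b) ≼ p → (b , c) ≼ q → (a , c) ≼ p ⊗ q
⊗-telescope-≼ {a} {b} {c} {x , y} {z , w} b>0 (mk≼ ay≤bx) (mk≼ bw≤cz) = mk≼ (*-cancelˡ-≤ b {{>-nonZero b>0}} (begin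
  b * (a * (y * w))  ≡⟨ trans (cong (b *_) (sym (*-assoc a y w))) (x∙yz≈y∙xz b (a * y) w) ⟩
  a * y * (b * w)    ≤⟨ *-mono-≤ ay≤bx bw≤cz ⟩
  b * x * (c * z)    ≡⟨ trans (*-assoc b x (c * z)) (cong (b *_) (x∙yz≈y∙xz x c z)) ⟩
  b * (c * (x * z))  ∎))
  where open ≤-Reasoning

⊗-assoc : ∀ p q r → p ⊗ q ⊗ r ≡ p ⊗ (q ⊗ r)
⊗-assoc (a , b) (c , d) (e , f) = cong₂ _,_ (*-assoc a c e) (*-assoc b d f)

≼-⊗-scale : ∀ p c → 0 < c → p ≼ p ⊗ (c , 1)
≼-⊗-scale (a , b) c c>0 = mk≼ (begin
  a * (b * 1)   ≡⟨ x∙yz≈y∙xz a b 1 ⟩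
  b * (a * 1)   ≤⟨ *-monoʳ-≤ b (*-monoʳ-≤ a c>0) ⟩
  b * (a * c)   ∎)
  where open ≤-Reasoning

-- a / (c d) = a / (c b) · b / d ≤ g / (h e) · e / f = g / (h f), where e may be 0.
≼-cancel-factor : ∀ {a b c d e f g h} → 0 < b →
                  (b , d) ≼ (e , f) → (a , c * b) ≼ (g , h * e) → (a , c * d) ≼ (g , h * f)
≼-cancel-factor {a} {b} {c} {d} {e} {f} {g} {h} b>0 (mk≼ bf≤de) (mk≼ ahe≤cbg) =
  mk≼ (*-cancelˡ-≤ b {{>-nonZero b>0}} (begin
    b * (a * (h * f))  ≡⟨ trans (cong (b *_) (sym (*-assoc a h f))) (x∙yz≈y∙xz b (a * h) f) ⟩
    a * h * (b * f)    ≤⟨ *-monoʳ-≤ (a * h) bf≤de ⟩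
    a * h * (d * e)    ≡⟨ trans (x∙yz≈y∙xz (a * h) d e) (cong (d *_) (*-assoc a h e)) ⟩
    d * (a * (h * e))  ≤⟨ *-monoʳ-≤ d ahe≤cbg ⟩
    d * (c * b * g)    ≡⟨ swap-factors d c b g ⟩
    b * (c * d * g)    ∎))
  where
  open ≤-Reasoning
  swap-factors : ∀ d c b g → d * (c * b * g) ≡ b * (c * d * g)
  swap-factors = solve-∀

≼-total : ∀ p q → p ≼ q ⊎ q ≼ p
≼-total (a , b) (c , d) with ≤-total (a * d) (b * c)
... | inj₁ ad≤bc = inj₁ (mk≼ ad≤bc)
... | inj₂ bc≤ad = inj₂ (mk≼ (subst₂ _≤_ (*-comm b c) (*-comm a d) bc≤ad))

≼-argmin : ∀ m (ρ : ℕ → ℕ × ℕ) → (∀ f → 0 < proj₂ (ρ f)) → 0 < m →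
           Σ ℕ λ f → f < m × (∀ g → g < m → ρ f ≼ ρ g)
≼-argmin (suc zero)    ρ ρ>0 _ = 0 , z<s , λ { zero _ → ≼-refl (ρ 0) ; (suc _) (s≤s ()) }
≼-argmin (suc (suc m)) ρ ρ>0 _ with f , f<m , f-min ← ≼-argmin (suc m) ρ ρ>0 z<s | ≼-total (ρ f) (ρ (suc m))
... | inj₁ f≼last = f , m≤n⇒m≤1+n f<m , λ g g<m →
  [ f-min g , (λ { refl → f≼last }) ]′ (m<1+n⇒m<n∨m≡n g<m)
... | inj₂ last≼f = suc m , ≤-refl , λ g g<m →
  [ ≼-trans (ρ>0 f) last≼f ∘ f-min g , (λ { refl → ≼-refl (ρ (suc m)) }) ]′ (m<1+n⇒m<n∨m≡n g<m)

m*n>0 : ∀ {m n} → 0 < m → 0 < n → 0 < m * n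
m*n>0 = *-mono-≤

prodUpTo : ℕ → (ℕ → ℕ) → ℕ
prodUpTo zero    g = 1
prodUpTo (suc m) g = g 0 * prodUpTo m (g ∘ suc)

product-applyUpTo : ∀ n (g f : ℕ → ℕ) → product (map g (applyUpTo f n)) ≡ prodUpTo n (g ∘ f)
product-applyUpTo zero    g f = refl
product-applyUpTo (suc n) g f = cong (g (f 0) *_) (product-applyUpTo n g (f ∘ suc))

prodUpTo-suc : ∀ m g → prodUpTo (suc m) g ≡ prodUpTo m g * g m
prodUpTo-suc zero    g = *-comm (g 0) 1
prodUpTo-suc (suc m) g = trans (cong (g 0 *_) (prodUpTo-suc m (g ∘ suc))) (sym (*-assoc (g 0) _ _))

prodUpTo-* : ∀ m g h → prodUpTo m (λ i → g i * h i) ≡ prodUpTo m g * prodUpTo m h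
prodUpTo-* zero    g h = refl
prodUpTo-* (suc m) g h = trans (cong (g 0 * h 0 *_) (prodUpTo-* m (g ∘ suc) (h ∘ suc))) (*-interchange (g 0) (h 0) _ _)

prodUpTo-const : ∀ m c → prodUpTo m (λ _ → c) ≡ c ^ m
prodUpTo-const zero    c = refl
prodUpTo-const (suc m) c = cong (c *_) (prodUpTo-const m c)

prodUpTo-swap : ∀ m n (F : ℕ → ℕ → ℕ) →
                prodUpTo m (λ i → prodUpTo n (F i)) ≡ prodUpTo n (λ j → prodUpTo m (λ i → F i j))
prodUpTo-swap zero    n F = sym (trans (prodUpTo-const n 1) (^-zeroˡ n))
prodUpTo-swap (suc m) n F = trans (cong (prodUpTo n (F 0) *_) (prodUpTo-swap m n (F ∘ suc)))
                                  (sym (prodUpTo-* n (F 0) (λ j → prodUpTo m (λ i → F (suc i) j))))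

prodUpTo-pos : ∀ m g → (∀ i → i < m → 0 < g i) → 0 < prodUpTo m g
prodUpTo-pos zero    g g>0 = z<s
prodUpTo-pos (suc m) g g>0 = m*n>0 (g>0 0 z<s) (prodUpTo-pos m (g ∘ suc) (λ i i<m → g>0 (suc i) (s≤s i<m)))

∏ᴿ : ℕ → (ℕ → ℕ × ℕ) → ℕ × ℕ
∏ᴿ m α = prodUpTo m (proj₁ ∘ α) , prodUpTo m (proj₂ ∘ α)

∏ᴿ-mono-≼ : ∀ m {α β} → (∀ i → i < m → α i ≼ β i) → ∏ᴿ m α ≼ ∏ᴿ m β
∏ᴿ-mono-≼ zero    α≼β = mk≼ ≤-refl
∏ᴿ-mono-≼ (suc m) α≼β = ⊗-mono-≼ (α≼β 0 z<s) (∏ᴿ-mono-≼ m (λ i i<m → α≼β (suc i) (s≤s i<m)))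

∏ᴿ-telescope-≼ : ∀ K (h : ℕ → ℕ) (α : ℕ → ℕ × ℕ) → (∀ k → 0 < h k) →
                (∀ k → k < K → (h k , h (suc k)) ≼ α k) → (h 0 , h K) ≼ ∏ᴿ K α
∏ᴿ-telescope-≼ zero    h α h>0 step = mk≼ ≤-refl
∏ᴿ-telescope-≼ (suc K) h α h>0 step = ⊗-telescope-≼ (h>0 1) (step 0 z<s)
  (∏ᴿ-telescope-≼ K (h ∘ suc) (α ∘ suc) (h>0 ∘ suc) (λ k k<K → step (suc k) (s≤s k<K)))

∏ᴿ-⊗ : ∀ m α β → ∏ᴿ m (λ i → α i ⊗ β i) ≡ ∏ᴿ m α ⊗ ∏ᴿ m β
∏ᴿ-⊗ m α β = cong₂ _,_ (prodUpTo-* m (proj₁ ∘ α) (proj₁ ∘ β)) (prodUpTo-* m (proj₂ ∘ α) (proj₂ ∘ β))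

∏ᴿ-const : ∀ m a b → ∏ᴿ m (λ _ → (a , b)) ≡ (a ^ m , b ^ m)
∏ᴿ-const m a b = cong₂ _,_ (prodUpTo-const m a) (prodUpTo-const m b)

∏ᴿ-swap : ∀ m n (α : ℕ → ℕ → ℕ × ℕ) → ∏ᴿ m (λ i → ∏ᴿ n (α i)) ≡ ∏ᴿ n (λ j → ∏ᴿ m (λ i → α i j))
∏ᴿ-swap m n α = cong₂ _,_ (prodUpTo-swap m n (λ i j → proj₁ (α i j))) (prodUpTo-swap m n (λ i j → proj₂ (α i j)))

productRatio : {X : Set} → (X → ℕ) → (X → ℕ) → List X → ℕ × ℕ
productRatio a b xs = product (map a xs) , product (map b xs)

productRatio-mono-⊆ : ∀ {X : Set} (a b : X → ℕ) → (∀ x → b x ≤ a x) →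
                      ∀ {ys xs} → ys ⊆ xs → productRatio a b ys ≼ productRatio a b xs
productRatio-mono-⊆ a b b≤a []              = mk≼ ≤-refl
productRatio-mono-⊆ a b b≤a (_∷_ {x = x} refl ys⊆xs) = ⊗-mono-≼ (≼-refl (a x , b x)) (productRatio-mono-⊆ a b b≤a ys⊆xs)
productRatio-mono-⊆ a b b≤a (_∷ʳ_ {ys = xs} x ys⊆xs) =
  subst (_≼ productRatio a b (x ∷ xs)) (cong₂ _,_ (*-identityˡ _) (*-identityˡ _))
    (⊗-mono-≼ {1 , 1} {a x , b x} (mk≼ (*-monoʳ-≤ 1 (b≤a x))) (productRatio-mono-⊆ a b b≤a ys⊆xs))

-- Bernoulli and AM–GM

+-cancelʳ-≤′ : ∀ {a b c d} x → a + x ≡ c → b + x ≡ d → c ≤ d → a ≤ b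
+-cancelʳ-≤′ {a} {b} x refl refl c≤d = +-cancelʳ-≤ x a b c≤d

n^n>0 : ∀ n → 0 < n ^ n
n^n>0 zero    = z<s
n^n>0 (suc n) = m^n>0 (suc n) (suc n)

^-distribʳ-* : ∀ m n o → (m * n) ^ o ≡ m ^ o * n ^ o
^-distribʳ-* m n zero    = refl
^-distribʳ-* m n (suc o) = trans (cong (m * n *_) (^-distribʳ-* m n o)) (*-interchange m n (m ^ o) (n ^ o))

2*m*n≤m*m+n*n : ∀ m n → 2 * m * n ≤ m * m + n * n
2*m*n≤m*m+n*n m n with ≤-total m n
... | inj₁ m≤n with d , refl ← m≤n⇒∃[o]m+o≡n m≤n =
  subst (2 * m * (m + d) ≤_) (square-gap m d) (m≤m+n _ (d * d))
  where square-gap : ∀ m d → 2 * m * (m + d) + d * d ≡ m * m + (m + d) * (m + d)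
        square-gap = solve-∀
... | inj₂ n≤m with d , refl ← m≤n⇒∃[o]m+o≡n n≤m =
  subst (2 * (n + d) * n ≤_) (square-gap n d) (m≤m+n _ (d * d))
  where square-gap : ∀ n d → 2 * (n + d) * n + d * d ≡ (n + d) * (n + d) + n * n
        square-gap = solve-∀

-- Bernoulli's inequality (p/q)^m ≥ 1 + m (p/q - 1), with the denominators cleared.
bernoulli : ∀ m p q → q ^ suc m + m * p * q ^ m ≤ p ^ m * q + m * q ^ suc m
bernoulli zero    p q = ≤-reflexive (base q p)
  where base : ∀ q p → q * 1 + 0 * p * 1 ≡ 1 * q + 0 * (q * 1)
        base = solve-∀
bernoulli (suc m) p q = +-cancelʳ-≤′ X (lhs m p q A B) (rhs m p q A B)
    (+-mono-≤ (+-mono-≤ (*-monoʳ-≤ p (bernoulli m p q)) (*-monoʳ-≤ (m * A) (2*m*n≤m*m+n*n p q))) ≤-refl)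
  where
  A = q ^ m
  B = p ^ m
  X = m * p * (q * A) + m * p * p * A
  lhs : ∀ m p q A B → q * (q * A) + suc m * p * (q * A) + (m * p * (q * A) + m * p * p * A)
        ≡ p * (q * A + m * p * A) + m * A * (2 * p * q) + q * (q * A)
  lhs = solve-∀
  rhs : ∀ m p q A B → p * B * q + suc m * (q * (q * A)) + (m * p * (q * A) + m * p * p * A)
        ≡ p * (B * q + m * (q * A)) + m * A * (p * p + q * q) + q * (q * A)
  rhs = solve-∀

[1+n]^[1+n]≤[1+n]²*n^n : ∀ n → suc n ^ suc n ≤ suc n * suc n * n ^ n
[1+n]^[1+n]≤[1+n]²*n^n n = subst (suc n * A ≤_) (regroup n B) (*-monoʳ-≤ (suc n) A≤B*[1+n])
  where
  A = suc n ^ n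
  B = n ^ n
  A≤B*[1+n] : A ≤ B * suc n
  A≤B*[1+n] = +-cancelʳ-≤′ (n * A + n * n * A) (lhs n A) (rhs n A B) (bernoulli n n (suc n))
    where
    lhs : ∀ n A → A + (n * A + n * n * A) ≡ (1 + n) * A + n * n * A
    lhs = solve-∀
    rhs : ∀ n A B → B * (1 + n) + (n * A + n * n * A) ≡ B * (1 + n) + n * ((1 + n) * A)
    rhs = solve-∀
  regroup : ∀ n B → (1 + n) * (B * (1 + n)) ≡ (1 + n) * (1 + n) * B
  regroup = solve-∀

-- Bernoulli at p = (s + x) m, q = s (m + 1).
amgm-step : ∀ m x s → x * s ^ m * suc m ^ suc m ≤ (s + x) ^ suc m * m ^ m
amgm-step m       zero    s = z≤n
amgm-step zero    (suc x) s = subst₂ _≤_ (*1*1 (suc x)) (*1*1 (s + suc x)) (m≤n+m (suc x) s)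
  where *1*1 : ∀ y → y ≡ y * 1 * 1
        *1*1 y = sym (trans (*-identityʳ (y * 1)) (*-identityʳ y))
amgm-step m@(suc _) x@(suc _) s = *-cancelˡ-≤ F {{>-nonZero F>0}} (begin
  F * (x * a * (suc m * b))          ≡⟨ e₁ F x a m b ⟩
  (x * suc m) * (a * b * F)          ≤⟨ *-monoʳ-≤ (x * suc m) I₁ ⟩
  (x * suc m) * (c * d * s * suc m)  ≡⟨ e₂ x m c d s ⟩
  (c * d) * (x * s * suc m * suc m)  ≤⟨ *-monoʳ-≤ (c * d) I₂ ⟩
  (c * d) * (t * F)                  ≡⟨ e₃ c d t F ⟩
  F * (t * c * d)                    ∎)
  where
  open ≤-Reasoning
  t = s + x
  a = s ^ m
  b = suc m ^ m
  c = t ^ m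
  d = m ^ m
  F = s + m * m * x
  F>0 : 0 < F
  F>0 = ≤-trans z<s (m≤n+m (m * m * x) s)
  I₁ : a * b * F ≤ c * d * s * suc m
  I₁ = +-cancelʳ-≤′ (m * (s * suc m) * (a * b)) (lhs m x s a b) (rhs m x s a b c d)
         (subst₂ (λ u v → s * suc m * u + m * (t * m) * u ≤ v * (s * suc m) + m * (s * suc m * u))
           (^-distribʳ-* s (suc m) m) (^-distribʳ-* t m m) (bernoulli m (t * m) (s * suc m)))
    where
    lhs : ∀ m x s a b → a * b * (s + m * m * x) + m * (s * (1 + m)) * (a * b)
          ≡ s * (1 + m) * (a * b) + m * ((s + x) * m) * (a * b)
    lhs = solve-∀
    rhs : ∀ m x s a b c d → c * d * s * (1 + m) + m * (s * (1 + m)) * (a * b)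
          ≡ c * d * (s * (1 + m)) + m * (s * (1 + m) * (a * b))
    rhs = solve-∀
  I₂ : x * s * suc m * suc m ≤ t * F
  I₂ = +-cancelʳ-≤′ (2 * s * (m * x)) refl (expand m x s) (+-monoʳ-≤ (x * s * suc m * suc m) (2*m*n≤m*m+n*n s (m * x)))
    where
    expand : ∀ m x s → (s + x) * (s + m * m * x) + 2 * s * (m * x) ≡ x * s * (1 + m) * (1 + m) + (s * s + m * x * (m * x))
    expand = solve-∀
  e₁ : ∀ F x a m b → F * (x * a * ((1 + m) * b)) ≡ (x * (1 + m)) * (a * b * F)
  e₁ = solve-∀
  e₂ : ∀ x m c d s → (x * (1 + m)) * (c * d * s * (1 + m)) ≡ (c * d) * (x * s * (1 + m) * (1 + m))
  e₂ = solve-∀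
  e₃ : ∀ c d t F → (c * d) * (t * F) ≡ F * (t * c * d)
  e₃ = solve-∀

amgm : ∀ xs → product xs * length xs ^ length xs ≤ sum xs ^ length xs
amgm []       = ≤-refl
amgm (x ∷ xs) = *-cancelˡ-≤ (m ^ m) {{>-nonZero (n^n>0 m)}} (begin
  m ^ m * (x * p * suc m ^ suc m)  ≡⟨ regroup (m ^ m) x p (suc m ^ suc m) ⟩
  x * (p * m ^ m) * suc m ^ suc m  ≤⟨ *-monoˡ-≤ (suc m ^ suc m) (*-monoʳ-≤ x (amgm xs)) ⟩
  x * s ^ m * suc m ^ suc m        ≤⟨ amgm-step m x s ⟩
  (s + x) ^ suc m * m ^ m          ≡⟨ cong (λ y → y ^ suc m * m ^ m) (+-comm s x) ⟩
  (x + s) ^ suc m * m ^ m          ≡⟨ *-comm _ (m ^ m) ⟩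
  m ^ m * (x + s) ^ suc m          ∎)
  where
  open ≤-Reasoning
  m = length xs
  p = product xs
  s = sum xs
  regroup : ∀ M x P N → M * (x * P * N) ≡ x * (P * M) * N
  regroup = solve-∀

product-replicate : ∀ n v → product (replicate n v) ≡ v ^ n
product-replicate zero    v = refl
product-replicate (suc n) v = cong (v *_) (product-replicate n v)

sum-replicate : ∀ n v → sum (replicate n v) ≡ n * v
sum-replicate zero    v = refl
sum-replicate (suc n) v = cong (v +_) (sum-replicate n v)

-- AM-GM for a copies of x b and b copies of y a.
weighted-amgm₂ : ∀ x y a b → ((a + b) ^ (a + b) , a ^ a * b ^ b) ≼ ((x + y) ^ (a + b) , x ^ a * y ^ b)
weighted-amgm₂ x y zero b = mk≼ (begin
  b ^ b * (1 * y ^ b)        ≡⟨ e (b ^ b) (y ^ b) ⟩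
  1 * b ^ b * y ^ b          ≤⟨ *-monoʳ-≤ (1 * b ^ b) (^-monoˡ-≤ b (m≤n+m y x)) ⟩
  1 * b ^ b * (x + y) ^ b    ∎)
  where
  open ≤-Reasoning
  e : ∀ u v → u * (1 * v) ≡ 1 * u * v
  e = solve-∀
weighted-amgm₂ x y a zero rewrite +-identityʳ a = mk≼ (begin
  a ^ a * (x ^ a * 1)        ≡⟨ e (a ^ a) (x ^ a) ⟩
  a ^ a * 1 * x ^ a          ≤⟨ *-monoʳ-≤ (a ^ a * 1) (^-monoˡ-≤ a (m≤m+n x y)) ⟩
  a ^ a * 1 * (x + y) ^ a    ∎)
  where
  open ≤-Reasoning
  e : ∀ u v → u * (v * 1) ≡ u * 1 * v
  e = solve-∀
weighted-amgm₂ x y a@(suc _) b@(suc _) = mk≼ (*-cancelˡ-≤ (Ab * Ba) {{>-nonZero Ab*Ba>0}} (begin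
  Ab * Ba * (N * (X * Y))                    ≡⟨ e₁ Ab Ba X Y N ⟩
  X * Ba * (Y * Ab) * N                      ≡⟨ cong₂ (λ u v → u * v * N) (sym (^-distribʳ-* x b a)) (sym (^-distribʳ-* y a b)) ⟩
  (x * b) ^ a * (y * a) ^ b * N              ≡⟨ cong₂ _*_ (sym product-L) (cong (λ u → u ^ u) (sym length-L)) ⟩
  product L * length L ^ length L            ≤⟨ amgm L ⟩
  sum L ^ length L                           ≡⟨ cong₂ _^_ sum-L length-L ⟩
  (a * (x * b) + b * (y * a)) ^ (a + b)      ≡⟨ cong (_^ (a + b)) (e₂ a b x y) ⟩
  (a * b * (x + y)) ^ (a + b)                ≡⟨ ^-distribʳ-* (a * b) (x + y) (a + b) ⟩
  (a * b) ^ (a + b) * W                      ≡⟨ cong (_* W) (^-distribʳ-* a b (a + b)) ⟩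
  a ^ (a + b) * b ^ (a + b) * W              ≡⟨ cong₂ (λ u v → u * v * W) (^-distribˡ-+-* a a b) (^-distribˡ-+-* b a b) ⟩
  Aa * Ab * (Ba * Bb) * W                    ≡⟨ e₃ Aa Ab Ba Bb W ⟩
  Ab * Ba * (Aa * Bb * W)                    ∎))
  where
  open ≤-Reasoning
  X = x ^ a
  Y = y ^ b
  Aa = a ^ a
  Ab = a ^ b
  Ba = b ^ a
  Bb = b ^ b
  W = (x + y) ^ (a + b)
  N = (a + b) ^ (a + b)
  Ab*Ba>0 : 0 < Ab * Ba
  Ab*Ba>0 = m*n>0 (m^n>0 a b) (m^n>0 b a)
  L = replicate a (x * b) ++ replicate b (y * a)
  length-L : length L ≡ a + b
  length-L = trans (length-++ (replicate a (x * b))) (cong₂ _+_ (length-replicate a) (length-replicate b))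
  product-L : product L ≡ (x * b) ^ a * (y * a) ^ b
  product-L = trans (product-++ (replicate a (x * b)) _) (cong₂ _*_ (product-replicate a (x * b)) (product-replicate b (y * a)))
  sum-L : sum L ≡ a * (x * b) + b * (y * a)
  sum-L = trans (sum-++ (replicate a (x * b)) _) (cong₂ _+_ (sum-replicate a (x * b)) (sum-replicate b (y * a)))
  e₁ : ∀ Ab Ba X Y N → Ab * Ba * (N * (X * Y)) ≡ X * Ba * (Y * Ab) * N
  e₁ = solve-∀
  e₂ : ∀ a b x y → a * (x * b) + b * (y * a) ≡ a * b * (x + y)
  e₂ = solve-∀
  e₃ : ∀ Aa Ab Ba Bb W → Aa * Ab * (Ba * Bb) * W ≡ Ab * Ba * (Aa * Bb * W)
  e₃ = solve-∀

-- Counting occurrences; Gibbs' inequality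

module _ {A : Set} {P : A → Set} (P? : Decidable P) where

  product-filter-partition : ∀ (g : A → ℕ) xs →
    product (map g xs) ≡ product (map g (filter P? xs)) * product (map g (filter (¬? ∘ P?) xs))
  product-filter-partition g []       = refl
  product-filter-partition g (x ∷ xs) with P? x
  ... | yes _ = trans (cong (g x *_) (product-filter-partition g xs)) (sym (*-assoc (g x) _ _))
  ... | no  _ = trans (cong (g x *_) (product-filter-partition g xs))
                      (x∙yz≈y∙xz (g x) (product (map g (filter P? xs))) (product (map g (filter (¬? ∘ P?) xs))))

  length-filter-partition : ∀ xs → length xs ≡ length (filter P? xs) + length (filter (¬? ∘ P?) xs)
  length-filter-partition []       = refl
  length-filter-partition (x ∷ xs) with P? x
  ... | yes _ = cong suc (length-filter-partition xs)
  ... | no  _ = trans (cong suc (length-filter-partition xs)) (sym (+-suc _ _))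

  product-filter-cong : ∀ (f g : A → ℕ) xs → (∀ x → P x → f x ≡ g x) →
    product (map f (filter P? xs)) ≡ product (map g (filter P? xs))
  product-filter-cong f g []       f≡g = refl
  product-filter-cong f g (x ∷ xs) f≡g with P? x
  ... | yes px = cong₂ _*_ (f≡g x px) (product-filter-cong f g xs f≡g)
  ... | no  _  = product-filter-cong f g xs f≡g

  product-filter-const : ∀ (f : A → ℕ) c xs → (∀ x → P x → f x ≡ c) →
    product (map f (filter P? xs)) ≡ c ^ length (filter P? xs)
  product-filter-const f c []       f≡c = refl
  product-filter-const f c (x ∷ xs) f≡c with P? x
  ... | yes px = cong₂ _*_ (f≡c x px) (product-filter-const f c xs f≡c)
  ... | no  _  = product-filter-const f c xs f≡c

module _ {B : Set} (_≟_ : DecidableEquality B) where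

  countProduct : List B → ℕ
  countProduct xs = product (map (λ x → count _≟_ x xs) xs)

  Distinct : List B → Set
  Distinct as = ∀ a → count _≟_ a as ≤ 1

  count-here : ∀ x ys → count _≟_ x (x ∷ ys) ≡ suc (count _≟_ x ys)
  count-here x ys with x ≟ x
  ... | yes _   = refl
  ... | no  x≢x = ⊥-elim (x≢x refl)

  count-there : ∀ {x y} ys → x ≢ y → count _≟_ x (y ∷ ys) ≡ count _≟_ x ys
  count-there {x} {y} ys x≢y with x ≟ y
  ... | yes x≡y = ⊥-elim (x≢y x≡y)
  ... | no  _   = refl

  count-here-pos : ∀ x ys → 0 < count _≟_ x (x ∷ ys)
  count-here-pos x ys = subst (0 <_) (sym (count-here x ys)) z<s

  count-∷-cong : ∀ x y {ys zs} → count _≟_ x ys ≡ count _≟_ x zs → count _≟_ x (y ∷ ys) ≡ count _≟_ x (y ∷ zs)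
  count-∷-cong x y eq with x ≟ y
  ... | yes _ = cong suc eq
  ... | no  _ = eq

  count-mono-⊆ : ∀ {ys xs} → ys ⊆ xs → ∀ x → count _≟_ x ys ≤ count _≟_ x xs
  count-mono-⊆ []                           x = z≤n
  count-mono-⊆ (_∷ʳ_ y ys⊆xs)               x with x ≟ y
  ... | yes _ = m≤n⇒m≤1+n (count-mono-⊆ ys⊆xs x)
  ... | no  _ = count-mono-⊆ ys⊆xs x
  count-mono-⊆ (_∷_ {x = y} refl ys⊆xs)    x with x ≟ y
  ... | yes _ = s≤s (count-mono-⊆ ys⊆xs x)
  ... | no  _ = count-mono-⊆ ys⊆xs x

  count-filter : ∀ {P : B → Set} (P? : Decidable P) x xs → P x → count _≟_ x (filter P? xs) ≡ count _≟_ x xs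
  count-filter P? x []       px = refl
  count-filter P? x (y ∷ ys) px with P? y
  ... | yes _ = count-∷-cong x y (count-filter P? x ys px)
  ... | no ¬py with x ≟ y
  ...   | yes refl = ⊥-elim (¬py px)
  ...   | no  _    = count-filter P? x ys px

  count-filter-reject : ∀ {P : B → Set} (P? : Decidable P) x xs → ¬ P x → count _≟_ x (filter P? xs) ≡ 0
  count-filter-reject P? x []       ¬px = refl
  count-filter-reject P? x (y ∷ ys) ¬px with P? y
  ... | no  _  = count-filter-reject P? x ys ¬px
  ... | yes py with x ≟ y
  ...   | yes refl = ⊥-elim (¬px py)
  ...   | no  _    = count-filter-reject P? x ys ¬px

  count≤length : ∀ x xs → count _≟_ x xs ≤ length xs
  count≤length x = length-filter (x ≟_)

  count-++ : ∀ x as bs → count _≟_ x (as ++ bs) ≡ count _≟_ x as + count _≟_ x bs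
  count-++ x as bs = trans (cong length (filter-++ (x ≟_) as bs)) (length-++ (filter (x ≟_) as))

  product-pos : ∀ (f : B → ℕ) ys → (∀ y → 0 < count _≟_ y ys → 0 < f y) → 0 < product (map f ys)
  product-pos f []       f>0 = z<s
  product-pos f (y ∷ ys) f>0 = m*n>0 (f>0 y (count-here-pos y ys))
    (product-pos f ys (λ z z∈ys → f>0 z (≤-trans z∈ys (count-mono-⊆ (y ∷ʳ ⊆-refl) z))))

  countProduct-pos : ∀ xs → 0 < countProduct xs
  countProduct-pos xs = product-pos (λ x → count _≟_ x xs) xs (λ _ x∈xs → x∈xs)

  product-split-count : ∀ (g : B → ℕ) x xs →
    product (map g xs) ≡ g x ^ count _≟_ x xs * product (map g (filter (¬? ∘ (x ≟_)) xs))
  product-split-count g x xs = trans (product-filter-partition (x ≟_) g xs)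
    (cong (_* product (map g (filter (¬? ∘ (x ≟_)) xs))) (product-filter-const (x ≟_) g (g x) xs (λ { _ refl → refl })))

  count-deduplicate : ∀ x xs → count _≟_ x xs ≡ 0 ⊎ count _≟_ x (deduplicate _≟_ xs) ≡ 1
  count-deduplicate x []       = inj₁ refl
  count-deduplicate x (y ∷ ys) with x ≟ y
  ... | yes refl = inj₂ (cong suc (count-filter-reject (¬? ∘ (x ≟_)) x (deduplicate _≟_ ys) (λ x≢x → x≢x refl)))
  ... | no  x≢y with count-deduplicate x ys
  ...   | inj₁ x∉ys = inj₁ x∉ys
  ...   | inj₂ once = inj₂ (trans (count-filter (¬? ∘ (y ≟_)) x (deduplicate _≟_ ys) (x≢y ∘ sym)) once)

  product-deduplicate : ∀ (h : B → ℕ) xs →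
    product (map h xs) ≡ product (map (λ b → h b ^ count _≟_ b xs) (deduplicate _≟_ xs))
  product-deduplicate h []       = refl
  product-deduplicate h (x ∷ xs) = begin
    h x * product (map h xs)                                  ≡⟨ cong (h x *_) (product-deduplicate h xs) ⟩
    h x * product (map g D)                                   ≡⟨ cong (h x *_) (product-split-count g x D) ⟩
    h x * ((h x ^ count _≟_ x xs) ^ count _≟_ x D * product (map g F))
                                                              ≡⟨ cong (λ u → h x * (u * product (map g F))) once ⟩
    h x * (h x ^ count _≟_ x xs * product (map g F))          ≡⟨ sym (*-assoc (h x) _ _) ⟩
    h x ^ suc (count _≟_ x xs) * product (map g F)            ≡⟨ cong₂ _*_ (cong (h x ^_) (sym (count-here x xs)))
                                                                   (product-filter-cong (¬? ∘ (x ≟_)) g g′ D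
                                                                     (λ b b≢x → cong (h b ^_) (sym (count-there xs (b≢x ∘ sym))))) ⟩
    h x ^ count _≟_ x (x ∷ xs) * product (map g′ F)           ∎
    where
    open ≡-Reasoning
    D = deduplicate _≟_ xs
    F = filter (¬? ∘ (x ≟_)) D
    g = λ b → h b ^ count _≟_ b xs
    g′ = λ b → h b ^ count _≟_ b (x ∷ xs)
    once : (h x ^ count _≟_ x xs) ^ count _≟_ x D ≡ h x ^ count _≟_ x xs
    once with count-deduplicate x xs
    ... | inj₁ eq rewrite eq = ^-zeroˡ (count _≟_ x D)
    ... | inj₂ eq rewrite eq = *-identityʳ _

  pp≡countProduct : ∀ xs → pp _≟_ xs ≡ countProduct xs
  pp≡countProduct xs = sym (product-deduplicate (λ x → count _≟_ x xs) xs)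

  countProduct-split : ∀ v vs → let r = filter (¬? ∘ (v ≟_)) vs in
    countProduct vs ≡ count _≟_ v vs ^ count _≟_ v vs * countProduct r
  countProduct-split v vs = trans (product-split-count (λ x → count _≟_ x vs) v vs)
    (cong (count _≟_ v vs ^ count _≟_ v vs *_)
      (product-filter-cong (¬? ∘ (v ≟_)) (λ x → count _≟_ x vs) (λ x → count _≟_ x r) vs
        (λ x x≢v → sym (count-filter (¬? ∘ (v ≟_)) x vs x≢v))))
    where r = filter (¬? ∘ (v ≟_)) vs

  countProduct-partition : ∀ {P : B → Set} (P? : Decidable P) xs →
    countProduct xs ≡ countProduct (filter P? xs) * countProduct (filter (¬? ∘ P?) xs)
  countProduct-partition P? xs = trans (product-filter-partition P? (λ p → count _≟_ p xs) xs)
    (cong₂ _*_ (product-filter-cong P? _ _ xs (λ p p∈ → sym (count-filter P? p xs p∈)))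
               (product-filter-cong (¬? ∘ P?) _ _ xs (λ p p∉ → sym (count-filter (¬? ∘ P?) p xs p∉))))

  countProduct-insert : ∀ as t bs → let c = count _≟_ t (as ++ bs) in
    countProduct (as ++ t ∷ bs) * c ^ c ≡ countProduct (as ++ bs) * suc c ^ suc c
  countProduct-insert as t bs = begin
    countProduct (as ++ t ∷ bs) * c ^ c                              ≡⟨ cong (_* c ^ c) (countProduct-split t (as ++ t ∷ bs)) ⟩
    count _≟_ t (as ++ t ∷ bs) ^ count _≟_ t (as ++ t ∷ bs) * countProduct (filter ≢t? (as ++ t ∷ bs)) * c ^ c
      ≡⟨ cong₂ (λ n xs → n ^ n * countProduct xs * c ^ c) count-t filter-t ⟩
    suc c ^ suc c * countProduct (filter ≢t? (as ++ bs)) * c ^ c     ≡⟨ xy∙z≈zy∙x (suc c ^ suc c) _ (c ^ c) ⟩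
    c ^ c * countProduct (filter ≢t? (as ++ bs)) * suc c ^ suc c     ≡⟨ cong (_* suc c ^ suc c) (sym (countProduct-split t (as ++ bs))) ⟩
    countProduct (as ++ bs) * suc c ^ suc c                          ∎
    where
    open ≡-Reasoning
    c = count _≟_ t (as ++ bs)
    ≢t? = ¬? ∘ (t ≟_)
    count-t : count _≟_ t (as ++ t ∷ bs) ≡ suc c
    count-t = begin
      count _≟_ t (as ++ t ∷ bs)               ≡⟨ count-++ t as (t ∷ bs) ⟩
      count _≟_ t as + count _≟_ t (t ∷ bs)    ≡⟨ cong (count _≟_ t as +_) (count-here t bs) ⟩
      count _≟_ t as + suc (count _≟_ t bs)    ≡⟨ +-suc _ _ ⟩
      suc (count _≟_ t as + count _≟_ t bs)    ≡⟨ cong suc (sym (count-++ t as bs)) ⟩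
      suc c                                    ∎
    filter-t : filter ≢t? (as ++ t ∷ bs) ≡ filter ≢t? (as ++ bs)
    filter-t = begin
      filter ≢t? (as ++ t ∷ bs)               ≡⟨ filter-++ ≢t? as (t ∷ bs) ⟩
      filter ≢t? as ++ filter ≢t? (t ∷ bs)    ≡⟨ cong (filter ≢t? as ++_) (filter-reject ≢t? (λ t≢t → t≢t refl)) ⟩
      filter ≢t? as ++ filter ≢t? bs          ≡⟨ sym (filter-++ ≢t? as bs) ⟩
      filter ≢t? (as ++ bs)                   ∎

  countProduct-insert-≥ : ∀ as t bs → countProduct (as ++ bs) ≤ countProduct (as ++ t ∷ bs)
  countProduct-insert-≥ as t bs = *-cancelʳ-≤ _ _ (c ^ c) {{>-nonZero (n^n>0 c)}} (begin
    countProduct (as ++ bs) * c ^ c          ≤⟨ *-monoʳ-≤ (countProduct (as ++ bs)) c^c≤ ⟩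
    countProduct (as ++ bs) * suc c ^ suc c  ≡⟨ sym (countProduct-insert as t bs) ⟩
    countProduct (as ++ t ∷ bs) * c ^ c      ∎)
    where
    open ≤-Reasoning
    c = count _≟_ t (as ++ bs)
    c^c≤ : c ^ c ≤ suc c ^ suc c
    c^c≤ = ≤-trans (^-monoˡ-≤ c (n≤1+n c)) (^-monoʳ-≤ (suc c) (n≤1+n c))

  countProduct-insert-≤ : ∀ as t bs → let c = count _≟_ t (as ++ bs) in
    countProduct (as ++ t ∷ bs) ≤ countProduct (as ++ bs) * (suc c * suc c)
  countProduct-insert-≤ as t bs = *-cancelˡ-≤ (c ^ c) {{>-nonZero (n^n>0 c)}} (begin
    c ^ c * countProduct (as ++ t ∷ bs)              ≡⟨ *-comm (c ^ c) _ ⟩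
    countProduct (as ++ t ∷ bs) * c ^ c              ≡⟨ countProduct-insert as t bs ⟩
    countProduct (as ++ bs) * suc c ^ suc c          ≤⟨ *-monoʳ-≤ (countProduct (as ++ bs)) ([1+n]^[1+n]≤[1+n]²*n^n c) ⟩
    countProduct (as ++ bs) * (suc c * suc c * c ^ c) ≡⟨ regroup (countProduct (as ++ bs)) (suc c * suc c) (c ^ c) ⟩
    c ^ c * (countProduct (as ++ bs) * (suc c * suc c)) ∎)
    where
    open ≤-Reasoning
    c = count _≟_ t (as ++ bs)
    regroup : ∀ a b d → a * (b * d) ≡ d * (a * b)
    regroup = solve-∀

  product-cong-support : ∀ (g h : B → ℕ) ys → (∀ y → 0 < count _≟_ y ys → g y ≡ h y) →
                         product (map g ys) ≡ product (map h ys)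
  product-cong-support g h []       g≡h = refl
  product-cong-support g h (y ∷ ys) g≡h = cong₂ _*_ (g≡h y (count-here-pos y ys))
    (product-cong-support g h ys (λ z z∈ys → g≡h z (≤-trans z∈ys (count-mono-⊆ (y ∷ʳ ⊆-refl) z))))

  All-count : ∀ {P : B → Set} {xs} → All P xs → ∀ x → 0 < count _≟_ x xs → P x
  All-count {xs = y ∷ ys} (py ∷ pys) x x∈ with x ≟ y
  ... | yes refl = py
  ... | no  _    = All-count pys x x∈

  sum-count≤length : ∀ as ws → Distinct as → sum (map (λ a → count _≟_ a ws) as) ≤ length ws
  sum-count≤length as []       distinct = ≤-reflexive (sum-zeros as)
    where sum-zeros : ∀ as → sum (map (λ a → count _≟_ a []) as) ≡ 0
          sum-zeros []       = refl
          sum-zeros (_ ∷ as) = sum-zeros as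
  sum-count≤length as (w ∷ ws) distinct = begin
    sum (map (λ a → count _≟_ a (w ∷ ws)) as)                                   ≡⟨ cong sum (map-cong (λ a → count-∷ a) as) ⟩
    sum (map (λ a → count _≟_ a (w ∷ []) + count _≟_ a ws) as)                  ≡⟨ sum-map-+ as ⟩
    sum (map (λ a → count _≟_ a (w ∷ [])) as) + sum (map (λ a → count _≟_ a ws) as)
                                                                                ≡⟨ cong (_+ _) (sum-count-singleton as) ⟩
    count _≟_ w as + sum (map (λ a → count _≟_ a ws) as)
      ≤⟨ +-mono-≤ (distinct w) (sum-count≤length as ws distinct) ⟩
    suc (length ws)                                                             ∎
    where
    open ≤-Reasoning
    count-∷ : ∀ a → count _≟_ a (w ∷ ws) ≡ count _≟_ a (w ∷ []) + count _≟_ a ws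
    count-∷ a with a ≟ w
    ... | yes _ = refl
    ... | no  _ = refl
    sum-map-+ : ∀ as → sum (map (λ a → count _≟_ a (w ∷ []) + count _≟_ a ws) as)
                       ≡ sum (map (λ a → count _≟_ a (w ∷ [])) as) + sum (map (λ a → count _≟_ a ws) as)
    sum-map-+ []       = refl
    sum-map-+ (a ∷ as) = trans (cong (count _≟_ a (w ∷ []) + count _≟_ a ws +_) (sum-map-+ as))
                               (+-interchange (count _≟_ a (w ∷ [])) (count _≟_ a ws) _ _)
    sum-count-singleton : ∀ as → sum (map (λ a → count _≟_ a (w ∷ [])) as) ≡ count _≟_ w as
    sum-count-singleton []       = refl
    sum-count-singleton (a ∷ as) with a ≟ w | w ≟ a
    ... | yes refl | yes _   = cong suc (sum-count-singleton as)
    ... | yes refl | no  w≢w = ⊥-elim (w≢w refl)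
    ... | no  a≢w  | yes w≡a = ⊥-elim (a≢w (sym w≡a))
    ... | no  _    | no  _   = sum-count-singleton as

  SubDistribution : (B → ℕ) → ℕ → List B → Set
  SubDistribution q Z vs = ∀ as → Distinct as → (∀ a → 0 < count _≟_ a as → 0 < count _≟_ a vs) → sum (map q as) ≤ Z

  SubDistribution-≤ : ∀ {q Z vs} v → SubDistribution q Z vs → 0 < count _≟_ v vs → q v ≤ Z
  SubDistribution-≤ {q} {Z} {vs} v sub v∈vs =
    subst (_≤ Z) (+-identityʳ (q v)) (sub (v ∷ []) (λ a → count≤length a (v ∷ [])) v-only)
    where
    v-only : ∀ a → 0 < count _≟_ a (v ∷ []) → 0 < count _≟_ a vs
    v-only a a∈[v] with a ≟ v
    ... | yes refl = v∈vs
    ... | no  _    = ⊥-elim (n≮0 a∈[v])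

  SubDistribution-remove : ∀ {q Z vs} v → SubDistribution q Z vs → 0 < count _≟_ v vs →
                           SubDistribution q (Z ∸ q v) (filter (¬? ∘ (v ≟_)) vs)
  SubDistribution-remove {q} {Z} {vs} v sub v∈vs as distinct as⊆r =
    m+n≤o⇒m≤o∸n (sum (map q as)) (subst (_≤ Z) (+-comm (q v) _) (sub (v ∷ as) distinct′ ⊆vs))
    where
    v∉as : count _≟_ v as ≡ 0
    v∉as with count _≟_ v as in eq
    ... | zero  = refl
    ... | suc _ = ⊥-elim (n≮0 (subst (0 <_) (count-filter-reject (¬? ∘ (v ≟_)) v vs (λ v≢v → v≢v refl))
                                     (as⊆r v (subst (0 <_) (sym eq) z<s))))
    distinct′ : Distinct (v ∷ as)
    distinct′ a with a ≟ v
    ... | yes refl = subst (λ n → suc n ≤ 1) (sym v∉as) ≤-refl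
    ... | no  _    = distinct a
    ⊆vs : ∀ a → 0 < count _≟_ a (v ∷ as) → 0 < count _≟_ a vs
    ⊆vs a a∈ with a ≟ v
    ... | yes refl = v∈vs
    ... | no  _    = ≤-trans (as⊆r a a∈) (count-mono-⊆ (filter-⊆ (¬? ∘ (v ≟_)) vs) a)

  -- Gibbs' inequality, exponentiated: 2^(n H(vs)) ≤ ∏_{v ∈ vs} Z / q v.
  gibbs : ∀ q Z vs → SubDistribution q Z vs →
          (length vs ^ length vs , countProduct vs) ≼ (Z ^ length vs , product (map q vs))
  gibbs q Z vs = go vs (<-wellFounded (length vs)) q Z
    where
    go : ∀ vs → Acc _<_ (length vs) → ∀ q Z → SubDistribution q Z vs →
         (length vs ^ length vs , countProduct vs) ≼ (Z ^ length vs , product (map q vs))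
    go []             _         q Z sub = mk≼ ≤-refl
    go vs@(v ∷ vs₁) (acc rec) q Z sub =
      subst₂ _≼_ (sym (cong₂ _,_ (cong (λ n → n ^ n) length≡) (countProduct-split v vs)))
                 (sym (cong₂ _,_ (cong₂ _^_ Z≡ length≡) (product-split-count q v vs)))
                 combined
      where
      c = count _≟_ v vs
      r = filter (¬? ∘ (v ≟_)) vs
      m = length r
      Z₁ = Z ∸ q v
      length≡ : length vs ≡ c + m
      length≡ = length-filter-partition (v ≟_) vs
      Z≡ : Z ≡ q v + Z₁
      Z≡ = sym (m+[n∸m]≡n (SubDistribution-≤ {q} {Z} {vs} v sub (count-here-pos v vs₁)))
      m<length : m < length vs
      m<length = subst (m <_) (sym length≡) (+-monoˡ-≤ m (count-here-pos v vs₁))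
      IH : (m ^ m , countProduct r) ≼ (Z₁ ^ m , product (map q r))
      IH = go r (rec m<length) q Z₁ (SubDistribution-remove {q} {Z} {vs} v sub (count-here-pos v vs₁))
      combined : ((c + m) ^ (c + m) , c ^ c * countProduct r) ≼ ((q v + Z₁) ^ (c + m) , q v ^ c * product (map q r))
      combined = ≼-cancel-factor {c = c ^ c} {h = q v ^ c} (n^n>0 m) IH (weighted-amgm₂ (q v) Z₁ c m)

module _ {B C : Set} (_≟B_ : DecidableEquality B) (_≟C_ : DecidableEquality C) (f : B → C) where

  count-map : ∀ x ys → (∀ y → 0 < count _≟B_ y ys → f x ≡ f y → x ≡ y) → count _≟C_ (f x) (map f ys) ≡ count _≟B_ x ys
  count-map x []       inj = refl
  count-map x (y ∷ ys) inj with f x ≟C f y | x ≟B y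
  ... | yes _     | yes _    = cong suc (count-map x ys inj-ys)
    where inj-ys = λ z z∈ys → inj z (≤-trans z∈ys (count-mono-⊆ _≟B_ (y ∷ʳ ⊆-refl) z))
  ... | yes fx≡fy | no  x≢y  = ⊥-elim (x≢y (inj y (count-here-pos _≟B_ y ys) fx≡fy))
  ... | no  fx≢fy | yes refl = ⊥-elim (fx≢fy refl)
  ... | no  _     | no  _    = count-map x ys inj-ys
    where inj-ys = λ z z∈ys → inj z (≤-trans z∈ys (count-mono-⊆ _≟B_ (y ∷ʳ ⊆-refl) z))

  countProduct-map : ∀ xs → (∀ x y → 0 < count _≟B_ x xs → 0 < count _≟B_ y xs → f x ≡ f y → x ≡ y) →
                     countProduct _≟C_ (map f xs) ≡ countProduct _≟B_ xs
  countProduct-map xs inj = trans (cong product (sym (map-∘ xs)))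
    (product-cong-support _≟B_ (λ x → count _≟C_ (f x) (map f xs)) (λ x → count _≟B_ x xs) xs
      (λ x x∈xs → count-map x xs (λ y y∈xs → inj x y x∈xs y∈xs)))

module _ {U V : Set} (_≟U_ : DecidableEquality U) (_≟V_ : DecidableEquality V) (_≟P_ : DecidableEquality (U × V)) where

  -- 2^(|L| H(V ∣ U)) for the empirical distribution of the pairs in L.
  conditionalRatio : List (U × V) → ℕ × ℕ
  conditionalRatio L = countProduct _≟U_ (map proj₁ L) , countProduct _≟P_ L

  fst≟ : (u : U) → Decidable (λ (p : U × V) → u ≡ proj₁ p)
  fst≟ u p = u ≟U proj₁ p

  count-fst : ∀ u L → count _≟U_ u (map proj₁ L) ≡ length (filter (fst≟ u) L)
  count-fst u []            = refl
  count-fst u ((u₁ , _) ∷ L) with u ≟U u₁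
  ... | yes _ = cong suc (count-fst u L)
  ... | no  _ = count-fst u L

  map-proj₁-filter : ∀ u L → map proj₁ (filter (¬? ∘ fst≟ u) L) ≡ filter (¬? ∘ (u ≟U_)) (map proj₁ L)
  map-proj₁-filter u []            = refl
  map-proj₁-filter u ((u₁ , _) ∷ L) with u ≟U u₁
  ... | yes _ = map-proj₁-filter u L
  ... | no  _ = cong (u₁ ∷_) (map-proj₁-filter u L)

  count-pair-filter-fst : ∀ u v L → count _≟P_ (u , v) (filter (fst≟ u) L) ≡ count _≟V_ v (map proj₂ (filter (fst≟ u) L))
  count-pair-filter-fst u v []            = refl
  count-pair-filter-fst u v ((u₁ , b) ∷ L) with u ≟U u₁
  ... | no  _    = count-pair-filter-fst u v L
  ... | yes refl with v ≟V b
  ...   | yes refl = trans (count-here _≟P_ (u , v) _) (cong suc (count-pair-filter-fst u v L))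
  ...   | no  v≢b  = trans (count-there _≟P_ _ (v≢b ∘ cong proj₂)) (count-pair-filter-fst u v L)

  count-pair≡count-snd : ∀ u v L → count _≟P_ (u , v) L ≡ count _≟V_ v (map proj₂ (filter (fst≟ u) L))
  count-pair≡count-snd u v L = trans (sym (count-filter _≟P_ (fst≟ u) (u , v) L refl)) (count-pair-filter-fst u v L)

  length-snd-filter : ∀ u L → length (map proj₂ (filter (fst≟ u) L)) ≡ count _≟U_ u (map proj₁ L)
  length-snd-filter u L = trans (length-map proj₂ (filter (fst≟ u) L)) (sym (count-fst u L))

  sum-count-pair≤count-fst : ∀ u as L → Distinct _≟V_ as →
                             sum (map (λ a → count _≟P_ (u , a) L) as) ≤ count _≟U_ u (map proj₁ L)
  sum-count-pair≤count-fst u as L distinct = subst₂ _≤_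
    (cong sum (map-cong (λ a → sym (count-pair≡count-snd u a L)) as)) (length-snd-filter u L)
    (sum-count≤length _≟V_ as (map proj₂ (filter (fst≟ u) L)) distinct)

  count-pair≤count-fst : ∀ u a L → count _≟P_ (u , a) L ≤ count _≟U_ u (map proj₁ L)
  count-pair≤count-fst u a L = subst₂ _≤_ (sym (count-pair≡count-snd u a L)) (length-snd-filter u L)
    (count≤length _≟V_ a (map proj₂ (filter (fst≟ u) L)))

  conditional-gibbs : ∀ (q : U → V → ℕ) (Z : U → ℕ) L → (∀ u as → Distinct _≟V_ as → sum (map (q u) as) ≤ Z u) →
                      conditionalRatio L ≼ (product (map (Z ∘ proj₁) L) , product (map (uncurry q) L))
  conditional-gibbs q Z L bound = go L (<-wellFounded (length L))
    where
    go : ∀ L → Acc _<_ (length L) → conditionalRatio L ≼ (product (map (Z ∘ proj₁) L) , product (map (uncurry q) L))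
    go []                   _         = mk≼ ≤-refl
    go L@((u , _) ∷ L′) (acc rec) = subst₂ _≼_ (sym ratio≡) (sym bound≡) (⊗-mono-≼ fibre (go Lr (rec shorter)))
      where
      Lu = filter (fst≟ u) L
      Lr = filter (¬? ∘ fst≟ u) L
      vs = map proj₂ Lu
      c = length Lu
      fibre : (c ^ c , countProduct _≟V_ vs) ≼ (Z u ^ c , product (map (q u) vs))
      fibre = subst (λ n → (n ^ n , countProduct _≟V_ vs) ≼ (Z u ^ n , product (map (q u) vs))) (length-map proj₂ Lu)
                (gibbs _≟V_ (q u) (Z u) vs (λ as distinct _ → bound u as distinct))
      shorter : length Lr < length L
      shorter = subst (length Lr <_) (sym (length-filter-partition (fst≟ u) L))
                  (+-monoˡ-≤ (length Lr) (subst (0 <_) (count-fst u L) (count-here-pos _≟U_ u (map proj₁ L′))))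
      ratio≡ : conditionalRatio L ≡ (c ^ c , countProduct _≟V_ vs) ⊗ conditionalRatio Lr
      ratio≡ = cong₂ _,_
        (trans (countProduct-split _≟U_ u (map proj₁ L))
               (cong₂ (λ n xs → n ^ n * countProduct _≟U_ xs) (count-fst u L) (sym (map-proj₁-filter u L))))
        (trans (countProduct-partition _≟P_ (fst≟ u) L)
               (cong (_* countProduct _≟P_ Lr)
                 (trans (product-filter-cong (fst≟ u) (λ p → count _≟P_ p Lu) (λ p → count _≟V_ (proj₂ p) vs) L
                          (λ { _ refl → count-pair-filter-fst u _ L }))
                        (cong product (map-∘ Lu)))))
      bound≡ : (product (map (Z ∘ proj₁) L) , product (map (uncurry q) L))
               ≡ (Z u ^ c , product (map (q u) vs)) ⊗ (product (map (Z ∘ proj₁) Lr) , product (map (uncurry q) Lr))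
      bound≡ = cong₂ _,_
        (trans (product-filter-partition (fst≟ u) (Z ∘ proj₁) L)
               (cong (_* product (map (Z ∘ proj₁) Lr)) (product-filter-const (fst≟ u) (Z ∘ proj₁) (Z u) L (λ { _ refl → refl }))))
        (trans (product-filter-partition (fst≟ u) (uncurry q) L)
               (cong (_* product (map (uncurry q) Lr))
                 (trans (product-filter-cong (fst≟ u) (uncurry q) (q u ∘ proj₂) L (λ { _ refl → refl }))
                        (cong product (map-∘ Lu)))))

  conditionalRatio-remove : ∀ as t bs n → length (as ++ bs) ≤ n →
    conditionalRatio (as ++ t ∷ bs) ≼ conditionalRatio (as ++ bs) ⊗ (suc n * suc n , 1)
  conditionalRatio-remove as t bs n length≤n = mk≼ (begin
    E L * (D L₁ * 1)                     ≡⟨ cong (E L *_) (*-identityʳ (D L₁)) ⟩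
    E L * D L₁                           ≤⟨ *-mono-≤ E-bound (countProduct-insert-≥ _≟P_ as t bs) ⟩
    E L₁ * (suc n * suc n) * D L         ≡⟨ *-comm _ (D L) ⟩
    D L * (E L₁ * (suc n * suc n))       ∎)
    where
    open ≤-Reasoning
    L = as ++ t ∷ bs
    L₁ = as ++ bs
    E = λ L → countProduct _≟U_ (map proj₁ L)
    D = countProduct _≟P_
    X = map proj₁ as
    Y = map proj₁ bs
    N = count _≟U_ (proj₁ t) (X ++ Y)
    N≤n : N ≤ n
    N≤n = ≤-trans (count≤length _≟U_ (proj₁ t) (X ++ Y))
            (≤-trans (≤-reflexive (trans (sym (cong length (map-++ proj₁ as bs))) (length-map proj₁ L₁))) length≤n)
    E-bound : E L ≤ E L₁ * (suc n * suc n)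
    E-bound = begin
      E L                        ≡⟨ cong (countProduct _≟U_) (map-++ proj₁ as (t ∷ bs)) ⟩
      countProduct _≟U_ (X ++ proj₁ t ∷ Y)  ≤⟨ countProduct-insert-≤ _≟U_ X (proj₁ t) Y ⟩
      countProduct _≟U_ (X ++ Y) * (suc N * suc N)  ≡⟨ cong (λ xs → countProduct _≟U_ xs * (suc N * suc N)) (sym (map-++ proj₁ as bs)) ⟩
      E L₁ * (suc N * suc N)     ≤⟨ *-monoʳ-≤ (E L₁) (*-mono-≤ (s≤s N≤n) (s≤s N≤n)) ⟩
      E L₁ * (suc n * suc n)     ∎

  conditionalRatio-drop-ends : ∀ pre T post n → length pre ≤ 1 → length post ≤ 1 → length (pre ++ T ++ post) ≤ n →
    conditionalRatio (pre ++ T ++ post) ≼ conditionalRatio T ⊗ (suc n * suc n * (suc n * suc n) , 1)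
  conditionalRatio-drop-ends pre T post n pre≤1 post≤1 length≤n =
    subst (conditionalRatio (pre ++ T ++ post) ≼_) (⊗-assoc (conditionalRatio T) (C , 1) (C , 1)) $
    ≼-trans (m*n>0 (countProduct-pos _≟P_ (T ++ post)) z<s)
      (drop-front pre (T ++ post) pre≤1 length≤n)
      (⊗-mono-≼ (drop-back T post post≤1 (≤-trans (m≤n+m _ (length pre)) (≤-trans (≤-reflexive (sym (length-++ pre))) length≤n)))
                (≼-refl (C , 1)))
    where
    C = suc n * suc n
    drop-front : ∀ pre L → length pre ≤ 1 → length (pre ++ L) ≤ n → conditionalRatio (pre ++ L) ≼ conditionalRatio L ⊗ (C , 1)
    drop-front []      L _ _        = ≼-⊗-scale (conditionalRatio L) C z<s
    drop-front (t ∷ []) L _ length≤ = conditionalRatio-remove [] t L n (≤-trans (n≤1+n _) length≤)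
    drop-front (_ ∷ _ ∷ _) L (s≤s ()) _
    drop-back : ∀ L post → length post ≤ 1 → length (L ++ post) ≤ n → conditionalRatio (L ++ post) ≼ conditionalRatio L ⊗ (C , 1)
    drop-back L []       _ _ rewrite ++-identityʳ L = ≼-⊗-scale (conditionalRatio L) C z<s
    drop-back L (t ∷ []) _ length≤ =
      subst (λ L₁ → conditionalRatio (L ++ t ∷ []) ≼ conditionalRatio L₁ ⊗ (C , 1)) (++-identityʳ L) $
      conditionalRatio-remove L t [] n
        (≤-trans (subst₂ _≤_ (sym (length-++ L)) (sym (length-++ L)) (+-monoʳ-≤ (length L) z≤n)) length≤)
    drop-back L (_ ∷ _ ∷ _) (s≤s ()) _

-- Contexts, blocks and the shifted parsings

module _ {A : Set} where

  take-+ : ∀ m n (xs : List A) → take (m + n) xs ≡ take m xs ++ take n (drop m xs)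
  take-+ zero    n       xs       = refl
  take-+ (suc m) zero    []       = refl
  take-+ (suc m) (suc n) []       = refl
  take-+ (suc m) n       (x ∷ xs) = cong (x ∷_) (take-+ m n xs)

  take-+-≤ : ∀ l k (xs : List A) → k ≤ l → take (l + k) xs ≡ take l xs ++ take k (take l (drop l xs))
  take-+-≤ l k xs k≤l = trans (take-+ l k xs)
    (cong (take l xs ++_) (sym (trans (take-take k l (drop l xs)) (cong (λ n → take n (drop l xs)) (m≤n⇒m⊓n≡m k≤l)))))

  ++-injective : ∀ (u u′ v v′ : List A) → length u ≡ length u′ → u ++ v ≡ u′ ++ v′ → u ≡ u′ × v ≡ v′
  ++-injective []      []       v v′ _  eq = refl , eq
  ++-injective (x ∷ u) (y ∷ u′) v v′ eq₁ eq with ∷-injective eq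
  ... | refl , eq′ with ++-injective u u′ v v′ (suc-injective eq₁) eq′
  ...   | refl , refl = refl , refl

  ctxPairs-short : ∀ K (W : List A) → length W ≤ K → ctxPairs K W ≡ []
  ctxPairs-short K []       _ = refl
  ctxPairs-short K (x ∷ xs) length≤K with drop K (x ∷ xs) in eq
  ... | []    = refl
  ... | _ ∷ _ with () ← trans (sym eq) (drop-all K (x ∷ xs) length≤K)

  ctxPairs-long : ∀ K (W : List A) → K < length W →
    Σ A λ a → ctxPairs K W ≡ (take K W , a) ∷ ctxPairs K (drop 1 W) × take (suc K) W ≡ take K W ++ [ a ]
  ctxPairs-long K (x ∷ xs) K<length with drop K (x ∷ xs) in eq
  ... | []    = ⊥-elim (n≮0 (subst (0 <_) (trans (sym (length-drop K (x ∷ xs))) (cong length eq)) (m<n⇒0<n∸m K<length)))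
  ... | a ∷ _ = a , refl , trans (cong (λ n → take n (x ∷ xs)) (+-comm 1 K))
                               (trans (take-+ K 1 (x ∷ xs)) (cong (λ w → take K (x ∷ xs) ++ take 1 w) eq))

  drop-ctxPairs : ∀ i K (W : List A) → drop i (ctxPairs K W) ≡ ctxPairs K (drop i W)
  drop-ctxPairs zero    K W        = refl
  drop-ctxPairs (suc i) K []       = refl
  drop-ctxPairs (suc i) K (x ∷ xs) with K <? length (x ∷ xs)
  ... | yes K<length with _ , eq , _ ← ctxPairs-long K (x ∷ xs) K<length rewrite eq = drop-ctxPairs i K xs
  ... | no  K≮length rewrite ctxPairs-short K (x ∷ xs) (≮⇒≥ K≮length) =
    sym (ctxPairs-short K (drop i xs) (begin
      length (drop i xs)  ≡⟨ length-drop i xs ⟩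
      length xs ∸ i       ≤⟨ m∸n≤m (length xs) i ⟩
      length xs           ≤⟨ n≤1+n _ ⟩
      suc (length xs)     ≤⟨ ≮⇒≥ K≮length ⟩
      K                   ∎))
    where open ≤-Reasoning

  ctxPairs-drop-⊆ : ∀ K i (W : List A) → ctxPairs K (drop i W) ⊆ ctxPairs K W
  ctxPairs-drop-⊆ K i W = subst (_⊆ ctxPairs K W) (drop-ctxPairs i K W) (drop-⊆ i (ctxPairs K W))

length≤length-concat : ∀ {A : Set} (ys : List (List A)) → All (λ y → y ≢ []) ys → length ys ≤ length (concat ys)
length≤length-concat []             []              = z≤n
length≤length-concat ([] ∷ ys)      ([]≢[] ∷ _)     = ⊥-elim ([]≢[] refl)
length≤length-concat ((x ∷ y) ∷ ys) (_ ∷ nonempty) =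
  s≤s (≤-trans (length≤length-concat ys nonempty) (≤-trans (m≤n+m _ (length y)) (≤-reflexive (sym (length-++ y)))))

adjacentPairs : {Y : Set} → List Y → List (Y × Y)
adjacentPairs (a ∷ b ∷ xs) = (a , b) ∷ adjacentPairs (b ∷ xs)
adjacentPairs _            = []

module _ {Y : Set} where

  All-adjacentPairs : ∀ {P : Y → Set} {xs} → All P xs → All (λ p → P (proj₁ p) × P (proj₂ p)) (adjacentPairs xs)
  All-adjacentPairs []                = []
  All-adjacentPairs (_ ∷ [])          = []
  All-adjacentPairs (pa ∷ pb ∷ pxs)   = (pa , pb) ∷ All-adjacentPairs (pb ∷ pxs)

  length-adjacentPairs : ∀ (xs : List Y) → length (adjacentPairs xs) ≤ length xs
  length-adjacentPairs []           = z≤n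
  length-adjacentPairs (_ ∷ [])     = z≤n
  length-adjacentPairs (_ ∷ b ∷ xs) = s≤s (length-adjacentPairs (b ∷ xs))

  adjacentPairs-snoc : ∀ (a : Y) xs zs → length zs ≤ 1 →
    Σ (List (Y × Y)) λ post → length post ≤ 1 × adjacentPairs (a ∷ xs ++ zs) ≡ adjacentPairs (a ∷ xs) ++ post
  adjacentPairs-snoc a []       []          _        = [] , z≤n , refl
  adjacentPairs-snoc a []       (z ∷ [])    _        = (a , z) ∷ [] , s≤s z≤n , refl
  adjacentPairs-snoc a []       (_ ∷ _ ∷ _) (s≤s ())
  adjacentPairs-snoc a (b ∷ xs) zs          length≤1 with post , post≤1 , eq ← adjacentPairs-snoc b xs zs length≤1 =
    post , post≤1 , cong ((a , b) ∷_) eq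

  adjacentPairs-ends : ∀ (a : Y) xs zs → length zs ≤ 1 →
    Σ (List (Y × Y)) λ pre → Σ (List (Y × Y)) λ post →
      length pre ≤ 1 × length post ≤ 1 × adjacentPairs (a ∷ xs ++ zs) ≡ pre ++ adjacentPairs xs ++ post
  adjacentPairs-ends a []       []       _        = [] , [] , z≤n , z≤n , refl
  adjacentPairs-ends a []       (z ∷ []) _        = (a , z) ∷ [] , [] , s≤s z≤n , z≤n , refl
  adjacentPairs-ends a []       (_ ∷ _ ∷ _) (s≤s ())
  adjacentPairs-ends a (b ∷ xs) zs       length≤1 with post , post≤1 , eq ← adjacentPairs-snoc b xs zs length≤1 =
    (a , b) ∷ [] , post , s≤s z≤n , post≤1 , cong ((a , b) ∷_) eq

module Blocks (l′ : ℕ) where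

  l : ℕ
  l = suc l′

  strideFrom : {X : Set} → ℕ → List X → List X
  strideFrom c       []       = []
  strideFrom zero    (x ∷ xs) = x ∷ strideFrom l′ xs
  strideFrom (suc c) (x ∷ xs) = strideFrom c xs

  strideFrom-drop : ∀ {X : Set} c (xs : List X) → strideFrom c xs ≡ strideFrom 0 (drop c xs)
  strideFrom-drop zero    xs       = refl
  strideFrom-drop (suc c) []       = refl
  strideFrom-drop (suc c) (x ∷ xs) = strideFrom-drop c xs

  strideFrom-⊆ : ∀ {X : Set} c (xs : List X) → strideFrom c xs ⊆ xs
  strideFrom-⊆ c       []       = []
  strideFrom-⊆ zero    (x ∷ xs) = refl ∷ strideFrom-⊆ l′ xs
  strideFrom-⊆ (suc c) (x ∷ xs) = x ∷ʳ strideFrom-⊆ c xs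

  prodUpTo-strides : ∀ {X : Set} (h : X → ℕ) xs → prodUpTo l (λ c → product (map h (strideFrom c xs))) ≡ product (map h xs)
  prodUpTo-strides h []       = trans (prodUpTo-const l 1) (^-zeroˡ l)
  prodUpTo-strides h (x ∷ xs) = begin
    h x * product (map h (strideFrom l′ xs)) * prodUpTo l′ (λ c → product (map h (strideFrom c xs)))
      ≡⟨ xy∙z≈x∙zy (h x) _ _ ⟩
    h x * (prodUpTo l′ (λ c → product (map h (strideFrom c xs))) * product (map h (strideFrom l′ xs)))
      ≡⟨ cong (h x *_) (sym (prodUpTo-suc l′ (λ c → product (map h (strideFrom c xs))))) ⟩
    h x * prodUpTo l (λ c → product (map h (strideFrom c xs)))
      ≡⟨ cong (h x *_) (prodUpTo-strides h xs) ⟩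
    h x * product (map h xs) ∎
    where open ≡-Reasoning

  blocks : {A : Set} → ℕ → List A → List (List A)
  blocks zero    W = []
  blocks (suc m) W = take l W ∷ blocks m (drop l W)

  -- For consecutive blocks u , v this lists the pair (u ++ take k v , k-th letter of v):
  -- the head of ctxPairs (l + k) W.
  blockCtxPairs : {A : Set} → ℕ → ℕ → List A → List (List A × A)
  blockCtxPairs k (suc (suc m)) W = take 1 (ctxPairs (l + k) W) ++ blockCtxPairs k (suc m) (drop l W)
  blockCtxPairs k _             W = []

  module _ {A : Set} where

    length-blocks : ∀ m (W : List A) → length (blocks m W) ≡ m
    length-blocks zero    W = refl
    length-blocks (suc m) W = cong suc (length-blocks m (drop l W))

    concat-blocks : ∀ m (W : List A) → concat (blocks m W) ++ drop (m * l) W ≡ W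
    concat-blocks zero    W = refl
    concat-blocks (suc m) W = begin
      (take l W ++ concat (blocks m (drop l W))) ++ drop (l + m * l) W             ≡⟨ ++-assoc (take l W) _ _ ⟩
      take l W ++ (concat (blocks m (drop l W)) ++ drop (l + m * l) W)
        ≡⟨ cong (λ w → take l W ++ (concat (blocks m (drop l W)) ++ w)) (sym (drop-drop l (m * l) W)) ⟩
      take l W ++ (concat (blocks m (drop l W)) ++ drop (m * l) (drop l W))        ≡⟨ cong (take l W ++_) (concat-blocks m (drop l W)) ⟩
      take l W ++ drop l W                                                         ≡⟨ take++drop≡id l W ⟩
      W                                                                            ∎
      where open ≡-Reasoning

    length-drop-block : ∀ m (W : List A) → suc m * l ≤ length W → m * l ≤ length (drop l W)
    length-drop-block m W le =
      subst (m * l ≤_) (sym (length-drop l W)) (m+n≤o⇒m≤o∸n (m * l) (subst (_≤ length W) (+-comm l (m * l)) le))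

    All-length-blocks : ∀ m (W : List A) → m * l ≤ length W → All (λ b → length b ≡ l) (blocks m W)
    All-length-blocks zero    W _  = []
    All-length-blocks (suc m) W le = trans (length-take l W) (m≤n⇒m⊓n≡m (≤-trans (m≤m+n l (m * l)) le))
                                     ∷ All-length-blocks m (drop l W) (length-drop-block m W le)

    ctxPairs-next-block : ∀ m k (W : List A) → k < l → suc (suc m) * l ≤ length W →
      Σ A λ a → ctxPairs (l + k) W ≡ (take (l + k) W , a) ∷ ctxPairs (l + k) (drop 1 W)
              × take (suc (l + k)) W ≡ take (l + k) W ++ [ a ]
    ctxPairs-next-block m k W k<l le = ctxPairs-long (l + k) W
      (≤-trans (≤-reflexive (sym (+-suc l k))) (≤-trans (+-monoʳ-≤ l k<l) (≤-trans (+-monoʳ-≤ l (m≤m+n l (m * l))) le)))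

    blockCtxPairs-contexts : ∀ k m (W : List A) → k < l → m * l ≤ length W →
      map proj₁ (blockCtxPairs k m W) ≡ map (λ p → proj₁ p ++ take k (proj₂ p)) (adjacentPairs (blocks m W))
    blockCtxPairs-contexts k zero          W k<l le = refl
    blockCtxPairs-contexts k (suc zero)    W k<l le = refl
    blockCtxPairs-contexts k (suc (suc m)) W k<l le
      with _ , eq , _ ← ctxPairs-next-block m k W k<l le
         | ih ← blockCtxPairs-contexts k (suc m) (drop l W) k<l (length-drop-block (suc m) W le)
      rewrite eq = cong₂ _∷_ (take-+-≤ l k W (<⇒≤ k<l)) ih

    blockCtxPairs-extended : ∀ k m (W : List A) → k < l → m * l ≤ length W →
      map (λ p → proj₁ p ++ [ proj₂ p ]) (blockCtxPairs k m W)
        ≡ map (λ p → proj₁ p ++ take (suc k) (proj₂ p)) (adjacentPairs (blocks m W))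
    blockCtxPairs-extended k zero          W k<l le = refl
    blockCtxPairs-extended k (suc zero)    W k<l le = refl
    blockCtxPairs-extended k (suc (suc m)) W k<l le
      with _ , eq , snoc-eq ← ctxPairs-next-block m k W k<l le
         | ih ← blockCtxPairs-extended k (suc m) (drop l W) k<l (length-drop-block (suc m) W le)
      rewrite eq = cong₂ _∷_ (trans (sym snoc-eq) (trans (cong (λ n → take n W) (sym (+-suc l k))) (take-+-≤ l (suc k) W k<l))) ih

    blockCtxPairs-⊆ : ∀ k m (W : List A) → k < l → m * l ≤ length W → blockCtxPairs k m W ⊆ strideFrom 0 (ctxPairs (l + k) W)
    blockCtxPairs-⊆ k zero          W k<l le = minimum _
    blockCtxPairs-⊆ k (suc zero)    W k<l le = minimum _
    blockCtxPairs-⊆ k (suc (suc m)) W k<l le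
      with _ , eq , _ ← ctxPairs-next-block m k W k<l le
         | ih ← blockCtxPairs-⊆ k (suc m) (drop l W) k<l (length-drop-block (suc m) W le)
      rewrite eq = refl ∷ subst (blockCtxPairs k (suc m) (drop l W) ⊆_) next-stride ih
      where
      next-stride : strideFrom 0 (ctxPairs (l + k) (drop l W)) ≡ strideFrom l′ (ctxPairs (l + k) (drop 1 W))
      next-stride = sym (trans (strideFrom-drop l′ _)
                               (cong (strideFrom 0) (trans (drop-ctxPairs l′ (l + k) (drop 1 W)) (cong (ctxPairs (l + k)) (drop-drop 1 l′ W)))))

    optionalPhrase : List A → List (List A)
    optionalPhrase []       = []
    optionalPhrase (x ∷ xs) = (x ∷ xs) ∷ []

    length-optionalPhrase : ∀ xs → length (optionalPhrase xs) ≤ 1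
    length-optionalPhrase []      = z≤n
    length-optionalPhrase (_ ∷ _) = s≤s z≤n

    body : List A → ℕ → List A
    body S f = drop (suc f) S

    blockCount : List A → ℕ → ℕ
    blockCount S f = length (body S f) / l

    remainder : List A → ℕ → List A
    remainder S f = drop (blockCount S f * l) (body S f)

    parsing : List A → ℕ → List (List A)
    parsing S f = take (suc f) S ∷ (blocks (blockCount S f) (body S f) ++ optionalPhrase (remainder S f))

    blockCount-fits : ∀ S f → blockCount S f * l ≤ length (body S f)
    blockCount-fits S f = m/n*n≤m (length (body S f)) l

    concat-parsing : ∀ S f → concat (parsing S f) ≡ S
    concat-parsing S f = begin
      take (suc f) S ++ concat (blocks M W ++ optionalPhrase R)
        ≡⟨ cong (take (suc f) S ++_) (sym (concat-++ (blocks M W) (optionalPhrase R))) ⟩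
      take (suc f) S ++ (concat (blocks M W) ++ concat (optionalPhrase R))
        ≡⟨ cong (λ w → take (suc f) S ++ (concat (blocks M W) ++ w)) (concat-optionalPhrase R) ⟩
      take (suc f) S ++ (concat (blocks M W) ++ R)                          ≡⟨ cong (take (suc f) S ++_) (concat-blocks M W) ⟩
      take (suc f) S ++ drop (suc f) S                                      ≡⟨ take++drop≡id (suc f) S ⟩
      S                                                                     ∎
      where
      open ≡-Reasoning
      W = body S f
      M = blockCount S f
      R = remainder S f
      concat-optionalPhrase : ∀ R → concat (optionalPhrase R) ≡ R
      concat-optionalPhrase []       = refl
      concat-optionalPhrase (x ∷ R) = ++-identityʳ (x ∷ R)

    parsing-nonempty : ∀ s S f → All (λ y → y ≢ []) (parsing (s ∷ S) f)
    parsing-nonempty s S f = (λ ()) ∷ Allₚ.++⁺ (All.map (λ { {_ ∷ _} _ () }) (All-length-blocks M W (blockCount-fits (s ∷ S) f)))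
                                               (optionalPhrase-nonempty (remainder (s ∷ S) f))
      where
      W = body (s ∷ S) f
      M = blockCount (s ∷ S) f
      optionalPhrase-nonempty : ∀ R → All (λ y → y ≢ []) (optionalPhrase R)
      optionalPhrase-nonempty []      = []
      optionalPhrase-nonempty (_ ∷ _) = (λ ()) ∷ []

    length-parsing : ∀ S f → length (parsing S f) ≤ (length S + l ∸ 1) / l + 1
    length-parsing S f = subst (length (parsing S f) ≤_) (+-comm 1 _) (s≤s (begin
      length (blocks M W ++ optionalPhrase R)        ≡⟨ length-++ (blocks M W) ⟩
      length (blocks M W) + length (optionalPhrase R) ≡⟨ cong (_+ length (optionalPhrase R)) (length-blocks M W) ⟩
      M + length (optionalPhrase R)                  ≤⟨ tail-bound R refl ⟩
      (length W + l′) / l                            ≤⟨ /-monoˡ-≤ l (+-monoˡ-≤ l′ length-W≤) ⟩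
      (length S + l′) / l                            ≡⟨ cong (_/ l) (cong (_∸ 1) (sym (+-suc (length S) l′))) ⟩
      (length S + l ∸ 1) / l                         ∎))
      where
      open ≤-Reasoning
      W = body S f
      M = blockCount S f
      R = remainder S f
      length-W≤ : length W ≤ length S
      length-W≤ = ≤-trans (≤-reflexive (length-drop (suc f) S)) (m∸n≤m (length S) (suc f))
      tail-bound : ∀ R → R ≡ remainder S f → M + length (optionalPhrase R) ≤ (length W + l′) / l
      tail-bound []      _  = ≤-trans (≤-reflexive (+-identityʳ M)) (/-monoˡ-≤ l (m≤m+n (length W) l′))
      tail-bound (_ ∷ R) eq = subst (_≤ (length W + l′) / l) (trans (m*n/n≡m (suc M) l) (+-comm 1 M))
                                (/-monoˡ-≤ l (subst (_≤ length W + l′) (cong suc (+-comm (M * l) l′)) (+-monoˡ-≤ l′ M*l<length)))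
        where
        M*l<length : M * l < length W
        M*l<length = m∸n≢0⇒n<m λ length≡0 →
          0≢1+n (trans (sym length≡0) (trans (sym (length-drop (M * l) W)) (cong length (sym eq))))

    parsing-phrases≤l : ∀ S f → f < l → All (λ y → length y ≤ l) (parsing S f)
    parsing-phrases≤l S f f<l = ≤-trans (≤-reflexive (length-take (suc f) S)) (≤-trans (m⊓n≤m (suc f) (length S)) f<l)
        ∷ Allₚ.++⁺ (All.map ≤-reflexive (All-length-blocks M W (blockCount-fits S f))) (remainder≤l (remainder S f) refl)
      where
      W = body S f
      M = blockCount S f
      remainder≤l : ∀ R → R ≡ remainder S f → All (λ y → length y ≤ l) (optionalPhrase R)
      remainder≤l []      _  = []
      remainder≤l (x ∷ R) eq = ≤-trans (≤-reflexive (trans (cong length eq) (length-drop (M * l) W)))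
        (≤-trans (≤-reflexive (cong (_∸ M * l) (m≡m%n+[m/n]*n (length W) l)))
          (≤-trans (≤-reflexive (m+n∸n≡m (length W % l) (M * l))) (<⇒≤ (m%n<n (length W) l)))) ∷ []

    parsing-inner-phrases : ∀ S f (i : Fin (length (parsing S f))) → 0 < toℕ i → suc (toℕ i) < length (parsing S f) →
                            length (lookup (parsing S f) i) ≡ l
    parsing-inner-phrases S f (Fin.suc i) _ (s≤s i+1<length) =
      inner (blocks (blockCount S f) (body S f)) (remainder S f) (All-length-blocks _ _ (blockCount-fits S f)) i i+1<length
      where
      inner : ∀ bs R → All (λ b → length b ≡ l) bs → (j : Fin (length (bs ++ optionalPhrase R))) →
              suc (toℕ j) < length (bs ++ optionalPhrase R) → length (lookup (bs ++ optionalPhrase R) j) ≡ l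
      inner []       (_ ∷ _) _              Fin.zero (s≤s ())
      inner (b ∷ bs) R       (length≡ ∷ _)  Fin.zero _          = length≡
      inner (b ∷ bs) R       (_ ∷ lengths)  (Fin.suc j) (s≤s j<)   = inner bs R lengths j j<

-- Entropy of the shifted parsings

entRatio : {A : Set} → DecidableEquality A → ℕ → List A → ℕ × ℕ
entRatio _≟_ k T = entNum _≟_ k T , entDen _≟_ k T

module _ {A : Set} (_≟_ : DecidableEquality A) where

  private
    _≟*_ = Listₚ.≡-dec _≟_
    _≟*×_ = Productₚ.≡-dec _≟*_ _≟_

  contextCount : ℕ → List A → List A × A → ℕ
  contextCount K S p = count _≟*_ (proj₁ p) (map proj₁ (ctxPairs K S))

  pairCount : ℕ → List A → List A × A → ℕ
  pairCount K S p = count _≟*×_ p (ctxPairs K S)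

  entRatio≡productRatio : ∀ K S → entRatio _≟_ K S ≡ productRatio (contextCount K S) (pairCount K S) (ctxPairs K S)
  entRatio≡productRatio K S = cong₂ _,_
    (trans (pp≡countProduct _≟*_ (map proj₁ P)) (cong product (sym (map-∘ P))))
    (pp≡countProduct _≟*×_ P)
    where P = ctxPairs K S

  ctxPairs-1 : ∀ (Y : List A) → ctxPairs 1 Y ≡ map (λ p → [ proj₁ p ] , proj₂ p) (adjacentPairs Y)
  ctxPairs-1 []           = refl
  ctxPairs-1 (_ ∷ [])     = refl
  ctxPairs-1 (a ∷ b ∷ Y)  = cong (_ ∷_) (ctxPairs-1 (b ∷ Y))

  entRatio-1≡conditionalRatio : ∀ Y →
    entRatio _≟_ 1 Y ≡ conditionalRatio _≟_ _≟_ (Productₚ.≡-dec _≟_ _≟_) (adjacentPairs Y)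
  entRatio-1≡conditionalRatio Y = cong₂ _,_
    (begin
      pp _≟*_ (map proj₁ (ctxPairs 1 Y))                  ≡⟨ pp≡countProduct _≟*_ (map proj₁ (ctxPairs 1 Y)) ⟩
      countProduct _≟*_ (map proj₁ (ctxPairs 1 Y))        ≡⟨ cong (countProduct _≟*_ ∘ map proj₁) (ctxPairs-1 Y) ⟩
      countProduct _≟*_ (map proj₁ (map wrap T))          ≡⟨ cong (countProduct _≟*_) (trans (sym (map-∘ T)) (map-∘ T)) ⟩
      countProduct _≟*_ (map [_] (map proj₁ T))
        ≡⟨ countProduct-map _≟_ _≟*_ [_] (map proj₁ T) (λ { _ _ _ _ refl → refl }) ⟩
      countProduct _≟_ (map proj₁ T)                      ∎)
    (begin
      pp (Productₚ.≡-dec _≟*_ _≟_) (ctxPairs 1 Y)          ≡⟨ pp≡countProduct (Productₚ.≡-dec _≟*_ _≟_) (ctxPairs 1 Y) ⟩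
      countProduct (Productₚ.≡-dec _≟*_ _≟_) (ctxPairs 1 Y) ≡⟨ cong (countProduct _) (ctxPairs-1 Y) ⟩
      countProduct (Productₚ.≡-dec _≟*_ _≟_) (map wrap T)
        ≡⟨ countProduct-map _ _ wrap T (λ { (_ , _) (_ , _) _ _ refl → refl }) ⟩
      countProduct (Productₚ.≡-dec _≟_ _≟_) T               ∎)
    where
    open ≡-Reasoning
    T = adjacentPairs Y
    wrap : A × A → List A × A
    wrap p = [ proj₁ p ] , proj₂ p

module ParsingEntropy (l′ : ℕ) {A : Set} (_≟_ : DecidableEquality A) where

  open Blocks l′

  private
    _≟*_ = Listₚ.≡-dec _≟_
    _≟*×_ = Productₚ.≡-dec _≟*_ _≟_
    _≟*×*_ = Productₚ.≡-dec _≟*_ _≟*_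

  blockRatio : List A → ℕ → List A → ℕ → ℕ × ℕ
  blockRatio S M W k = productRatio (contextCount _≟_ (l + k) S) (pairCount _≟_ (l + k) S) (blockCtxPairs k M W)

  contextsUpTo : List (List A × List A) → ℕ → List (List A)
  contextsUpTo T k = map (λ p → proj₁ p ++ take k (proj₂ p)) T

  -- Conditional Gibbs against the statistics of the contexts of length l + k in S.
  chain-rule-step : ∀ S M W k → k < l → M * l ≤ length W → let T = adjacentPairs (blocks M W) in
    (countProduct _≟*_ (contextsUpTo T k) , countProduct _≟*_ (contextsUpTo T (suc k))) ≼ blockRatio S M W k
  chain-rule-step S M W k k<l fits =
    subst (_≼ blockRatio S M W k) (cong₂ _,_ (cong (countProduct _≟*_) (blockCtxPairs-contexts k M W k<l fits)) extended)
      (conditional-gibbs _≟*_ _≟_ _≟*×_ (λ u a → count _≟*×_ (u , a) P) (λ u → count _≟*_ u (map proj₁ P)) L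
        (λ u as distinct → sum-count-pair≤count-fst _≟*_ _≟_ _≟*×_ u as P distinct))
    where
    P = ctxPairs (l + k) S
    L = blockCtxPairs k M W
    snoc : List A × A → List A
    snoc p = proj₁ p ++ [ proj₂ p ]
    extended : countProduct _≟*×_ L ≡ countProduct _≟*_ (contextsUpTo (adjacentPairs (blocks M W)) (suc k))
    extended = trans (sym (countProduct-map _≟*×_ _≟*_ snoc L (λ x y _ _ → snoc-injective x y)))
                     (cong (countProduct _≟*_) (blockCtxPairs-extended k M W k<l fits))
      where
      snoc-injective : ∀ x y → snoc x ≡ snoc y → x ≡ y
      snoc-injective (u , a) (w , b) eq with refl , refl ← ∷ʳ-injective u w eq = refl

  -- contextsUpTo T 0 lists the first blocks of the pairs in T and contextsUpTo T l the pairs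
  -- themselves, so the ratio telescopes over the steps k < l.
  chain-rule : ∀ S M W → M * l ≤ length W →
    conditionalRatio _≟*_ _≟*_ _≟*×*_ (adjacentPairs (blocks M W)) ≼ ∏ᴿ l (blockRatio S M W)
  chain-rule S M W fits = subst (_≼ ∏ᴿ l (blockRatio S M W)) (cong₂ _,_ no-extension full-extension)
    (∏ᴿ-telescope-≼ l (countProduct _≟*_ ∘ contextsUpTo T) (blockRatio S M W)
      (λ k → countProduct-pos _≟*_ (contextsUpTo T k)) (λ k k<l → chain-rule-step S M W k k<l fits))
    where
    T = adjacentPairs (blocks M W)
    no-extension : countProduct _≟*_ (contextsUpTo T 0) ≡ countProduct _≟*_ (map proj₁ T)
    no-extension = cong (countProduct _≟*_) (map-cong (λ p → ++-identityʳ (proj₁ p)) T)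
    full-extension : countProduct _≟*_ (contextsUpTo T l) ≡ countProduct _≟*×*_ T
    full-extension = countProduct-map _≟*×*_ _≟*_ (λ p → proj₁ p ++ take l (proj₂ p)) T injective
      where
      lengths : All (λ p → length (proj₁ p) ≡ l × length (proj₂ p) ≡ l) T
      lengths = All-adjacentPairs (All-length-blocks M W fits)
      injective : ∀ x y → 0 < count _≟*×*_ x T → 0 < count _≟*×*_ y T →
                  proj₁ x ++ take l (proj₂ x) ≡ proj₁ y ++ take l (proj₂ y) → x ≡ y
      injective (u , v) (u′ , v′) x∈T y∈T eq
        with |u| , |v| ← All-count _≟*×*_ lengths (u , v) x∈T | |u′| , |v′| ← All-count _≟*×*_ lengths (u′ , v′) y∈T
        with refl , refl ← ++-injective u u′ v v′ (trans |u| (sym |u′|))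
                             (subst₂ (λ w w′ → u ++ w ≡ u′ ++ w′)
                                     (take-all l v (≤-reflexive |v|)) (take-all l v′ (≤-reflexive |v′|)) eq)
        = refl

  parsing-bound : ∀ (s : A) S₁ f → let S = s ∷ S₁ ; C = suc (length S) * suc (length S) in
    entRatio _≟*_ 1 (parsing S f) ≼ ∏ᴿ l (blockRatio S (blockCount S f) (body S f)) ⊗ (C * C , 1)
  parsing-bound s S₁ f
    with pre , post , pre≤1 , post≤1 , ends ←
           adjacentPairs-ends (take (suc f) (s ∷ S₁)) (blocks (blockCount (s ∷ S₁) f) (body (s ∷ S₁) f))
                              (optionalPhrase (remainder (s ∷ S₁) f)) (length-optionalPhrase (remainder (s ∷ S₁) f))
    = subst (_≼ ∏ᴿ l (blockRatio S M W) ⊗ (C * C , 1)) (sym (trans (entRatio-1≡conditionalRatio _≟*_ Y) (cong ρ ends)))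
        (≼-trans (m*n>0 (countProduct-pos _≟*×*_ T) z<s)
          (conditionalRatio-drop-ends _≟*_ _≟*_ _≟*×*_ pre T post (length S) pre≤1 post≤1
            (subst (λ P → length P ≤ length S) ends length≤))
          (⊗-mono-≼ (chain-rule S M W (blockCount-fits S f)) (≼-refl (C * C , 1))))
    where
    S = s ∷ S₁
    C = suc (length S) * suc (length S)
    W = body S f
    M = blockCount S f
    Y = parsing S f
    T = adjacentPairs (blocks M W)
    ρ = conditionalRatio _≟*_ _≟*_ _≟*×*_
    length≤ : length (adjacentPairs Y) ≤ length S
    length≤ = ≤-trans (length-adjacentPairs Y)
                (≤-trans (length≤length-concat Y (parsing-nonempty s S₁ f)) (≤-reflexive (cong length (concat-parsing S f))))

  blockCtxPairs-⊆-stride : ∀ (s : A) S₁ f k → k < l → let S = s ∷ S₁ in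
    blockCtxPairs k (blockCount S f) (body S f) ⊆ strideFrom f (ctxPairs (l + k) S₁)
  blockCtxPairs-⊆-stride s S₁ f k k<l = subst (blockCtxPairs k (blockCount S f) (body S f) ⊆_)
    (trans (cong (strideFrom 0) (sym (drop-ctxPairs f (l + k) S₁))) (sym (strideFrom-drop f (ctxPairs (l + k) S₁))))
    (blockCtxPairs-⊆ k (blockCount S f) (body S f) k<l (blockCount-fits S f))
    where S = s ∷ S₁

  pairCount-pos : ∀ K S {xs} → xs ⊆ ctxPairs K S → 0 < product (map (pairCount _≟_ K S) xs)
  pairCount-pos K S {xs} xs⊆ =
    product-pos _≟*×_ (pairCount _≟_ K S) xs (λ p p∈xs → ≤-trans p∈xs (count-mono-⊆ _≟*×_ xs⊆ p))

  blockRatio-pos : ∀ (s : A) S₁ f k → k < l → let S = s ∷ S₁ in 0 < proj₂ (blockRatio S (blockCount S f) (body S f) k)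
  blockRatio-pos s S₁ f k k<l = pairCount-pos (l + k) (s ∷ S₁)
    (⊆-trans (blockCtxPairs-⊆-stride s S₁ f k k<l)
      (⊆-trans (strideFrom-⊆ f (ctxPairs (l + k) S₁)) (ctxPairs-drop-⊆ (l + k) 1 (s ∷ S₁))))

  -- Over the l shifts f, the block contexts lie in the disjoint strides strideFrom f of the
  -- contexts of S₁.
  strides-bound : ∀ (s : A) S₁ k → k < l → let S = s ∷ S₁ in
    ∏ᴿ l (λ f → blockRatio S (blockCount S f) (body S f) k) ≼ entRatio _≟_ (l + k) S
  strides-bound s S₁ k k<l = subst (∏ᴿ l α ≼_) (sym (entRatio≡productRatio _≟_ K S))
    (≼-trans {q = productRatio a b P₁} (pairCount-pos K S (ctxPairs-drop-⊆ K 1 S))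
      (subst (∏ᴿ l α ≼_) (cong₂ _,_ (prodUpTo-strides a P₁) (prodUpTo-strides b P₁))
        (∏ᴿ-mono-≼ l {β = λ f → productRatio a b (strideFrom f P₁)}
          (λ f _ → productRatio-mono-⊆ a b b≤a (blockCtxPairs-⊆-stride s S₁ f k k<l))))
      (productRatio-mono-⊆ a b b≤a (ctxPairs-drop-⊆ K 1 S)))
    where
    S = s ∷ S₁
    α : ℕ → ℕ × ℕ
    α f = blockRatio S (blockCount S f) (body S f) k
    K = l + k
    P₁ = ctxPairs K S₁
    a = contextCount _≟_ K S
    b = pairCount _≟_ K S
    b≤a : ∀ p → b p ≤ a p
    b≤a (u , x) = count-pair≤count-fst _≟*_ _≟_ _≟*×_ u x (ctxPairs K S)

  -- The best shift does at least as well as the geometric mean over all l shifts.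
  best-parsing-bound : ∀ (s : A) S₁ → let S = s ∷ S₁ ; n = length S in Σ ℕ λ f → f < l ×
    entNum _≟*_ 1 (parsing S f) ^ l * prodRange l (λ i → entDen _≟_ i S)
      ≤ entDen _≟*_ 1 (parsing S f) ^ l * prodRange l (λ i → entNum _≟_ i S) * (n + 2) ^ (4 * l)
  best-parsing-bound s S₁ = f , f<l , (begin
    E ^ l * prodRange l (λ i → entDen _≟_ i S)  ≡⟨ cong (E ^ l *_) Den≡ ⟩
    E ^ l * (Den * 1 ^ l)                       ≤⟨ cross-≤ (subst₂ _≼_ (∏ᴿ-const l E D) (cong (∏ᴿ l σ ⊗_) (∏ᴿ-const l K 1)) bound) ⟩
    D ^ l * (Num * K ^ l)                       ≤⟨ *-monoʳ-≤ (D ^ l) (*-monoʳ-≤ Num K^l≤) ⟩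
    D ^ l * (Num * (n + 2) ^ (4 * l))           ≡⟨ sym (*-assoc (D ^ l) Num _) ⟩
    D ^ l * Num * (n + 2) ^ (4 * l)             ≡⟨ cong (λ x → D ^ l * x * (n + 2) ^ (4 * l)) (sym Num≡) ⟩
    D ^ l * prodRange l (λ i → entNum _≟_ i S) * (n + 2) ^ (4 * l) ∎)
    where
    open ≤-Reasoning
    S = s ∷ S₁
    n = length S
    K = suc n * suc n * (suc n * suc n)
    ρ : ℕ → ℕ × ℕ
    ρ f = entRatio _≟*_ 1 (parsing S f)
    β : ℕ → ℕ → ℕ × ℕ
    β f k = blockRatio S (blockCount S f) (body S f) k
    σ : ℕ → ℕ × ℕ
    σ k = entRatio _≟_ (l + k) S
    ρ>0 : ∀ f → 0 < proj₂ (ρ f)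
    ρ>0 f = subst (λ p → 0 < proj₂ p) (sym (entRatio-1≡conditionalRatio _≟*_ (parsing S f)))
                  (countProduct-pos _≟*×*_ (adjacentPairs (parsing S f)))
    best = ≼-argmin l ρ ρ>0 z<s
    f = proj₁ best
    f<l = proj₁ (proj₂ best)
    E = proj₁ (ρ f)
    D = proj₂ (ρ f)
    Num = prodUpTo l (proj₁ ∘ σ)
    Den = prodUpTo l (proj₂ ∘ σ)
    Num≡ : prodRange l (λ i → entNum _≟_ i S) ≡ Num
    Num≡ = product-applyUpTo l (λ k → entNum _≟_ (l + k) S) id
    Den≡ : prodRange l (λ i → entDen _≟_ i S) ≡ Den * 1 ^ l
    Den≡ = trans (product-applyUpTo l (λ k → entDen _≟_ (l + k) S) id)
                 (sym (trans (cong (Den *_) (^-zeroˡ l)) (*-identityʳ Den)))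
    bound : ∏ᴿ l (λ _ → ρ f) ≼ ∏ᴿ l σ ⊗ ∏ᴿ l (λ _ → (K , 1))
    bound =
      ≼-trans (prodUpTo-pos l (proj₂ ∘ ρ) (λ g _ → ρ>0 g)) (∏ᴿ-mono-≼ l (proj₂ (proj₂ best))) $
      ≼-trans β>0
        (subst (∏ᴿ l ρ ≼_) regroup (∏ᴿ-mono-≼ l (λ g _ → parsing-bound s S₁ g)))
        (⊗-mono-≼ (∏ᴿ-mono-≼ l (strides-bound s S₁)) (≼-refl (∏ᴿ l (λ _ → (K , 1)))))
      where
      regroup : ∏ᴿ l (λ g → ∏ᴿ l (β g) ⊗ (K , 1)) ≡ ∏ᴿ l (λ k → ∏ᴿ l (λ g → β g k)) ⊗ ∏ᴿ l (λ _ → (K , 1))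
      regroup = trans (∏ᴿ-⊗ l (λ g → ∏ᴿ l (β g)) (λ _ → (K , 1))) (cong (_⊗ ∏ᴿ l (λ _ → (K , 1))) (∏ᴿ-swap l l β))
      β>0 : 0 < proj₂ (∏ᴿ l (λ k → ∏ᴿ l (λ g → β g k)) ⊗ ∏ᴿ l (λ _ → (K , 1)))
      β>0 = m*n>0 (prodUpTo-pos l _ (λ k k<l → prodUpTo-pos l _ (λ g _ → blockRatio-pos s S₁ g k k<l)))
                  (prodUpTo-pos l (λ _ → 1) (λ _ _ → z<s))
    K^l≤ : K ^ l ≤ (n + 2) ^ (4 * l)
    K^l≤ = ≤-trans (^-monoˡ-≤ l K≤) (≤-reflexive (^-*-assoc (n + 2) 4 l))
      where
      n+1≤ : suc n ≤ n + 2
      n+1≤ = ≤-trans (n≤1+n (suc n)) (≤-reflexive (+-comm 2 n))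
      fourth-power : ∀ x → x * x * (x * x) ≡ x * (x * (x * (x * 1)))
      fourth-power = solve-∀
      K≤ : K ≤ (n + 2) ^ 4
      K≤ = ≤-trans (*-mono-≤ (*-mono-≤ n+1≤ n+1≤) (*-mono-≤ n+1≤ n+1≤)) (≤-reflexive (fourth-power (n + 2)))

theorem4 : Σ ℕ λ c → (σ : ℕ) (l : ℕ) .{{_ : NonZero l}} (S : Str σ) →
    Σ (List (Str σ)) λ Y →
      concat Y ≡ S
      × All (λ y → y ≢ []) Y
      × length Y ≤ (length S + l ∸ 1) / l + 1
      × All (λ y → length y ≤ l) Y
      × ((i : Fin (length Y)) → 0 < toℕ i → suc (toℕ i) < length Y → length (lookup Y i) ≡ l)
      × entNum (decStr σ) 1 Y ^ l * prodRange l (λ i → entDen _≟F_ i S)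
          ≤ entDen (decStr σ) 1 Y ^ l * prodRange l (λ i → entNum _≟F_ i S) * (length S + 2) ^ (c * l)
theorem4 = 4 , λ where
  -- For S = [] every entNum and entDen is pp [] = 1.
  σ (suc l′) []       → [] , refl , [] , z≤n , [] , (λ ()) , m≤m*n _ (2 ^ (4 * suc l′)) {{m^n≢0 2 (4 * suc l′)}}
  σ (suc l′) (s ∷ S₁) →
    let open Blocks l′
        f , f<l , entropy-bound = ParsingEntropy.best-parsing-bound l′ _≟F_ s S₁
        S = s ∷ S₁
    in parsing S f , concat-parsing S f , parsing-nonempty s S₁ f , length-parsing S f ,
       parsing-phrases≤l S f f<l , parsing-inner-phrases S f , entropy-bound
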